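{- Let $G$ be a plane graph whose outer face is bounded by the cycle $v_1v_2\dots v_kv_1$, with $V(G)=\{v_1,\dots,v_k,u,v\}$ where $u,v$ lie inside the cycle, and suppose there is $3\le i\le k-1$ such that $N_G(u)=\{v,v_1,\dots,v_i\}$ and $N_G(v)=\{u,v_i,\dots,v_k,v_1\}$. Then $P(G-\overrightarrow{v_kv_1v_2})$ contains a non-vanishing monomial $\eta\, v_1^0v_2^0v_k^0v^{\alpha_v}u^{\alpha_u}\prod_{r=3}^{k-1}v_r^{\alpha_r}$ with $\alpha_r\le2$ and $\alpha_v,\alpha_u\le4$.
   Context: For a graph $G$, vertices are also variables and $P(G)=\prod_{xy\in E(G),\,x<y}(x-y)$ for a fixed arbitrary orientation; a monomial is non-vanishing if its coefficient is nonzero. $G-\overrightarrow{v_kv_1v_2}$ is $G$ with edges $v_kv_1,v_1v_2$ deleted (vertices kept). -}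

module Defs where

open import Data.Nat using (ℕ; zero; suc; _+_; _∸_; _≟_)
open import Data.Integer using (ℤ; -_) renaming (_+_ to _+ℤ_; +_ to ℤ⁺)
open import Data.List using (List; []; _∷_; _++_; map; upTo; filter; concatMap)
open import Data.Vec using (Vec; []; _∷_; replicate; zipWith)
import Data.Vec.Properties as VecP
open import Data.Product using (_×_; _,_)
open import Data.Bool using (Bool; true; false; _∧_; _∨_; not)
open import Relation.Nullary using (yes; no; ¬_)
open import Relation.Nullary.Decidable using (⌊_⌋)

-- Multivariate polynomials over ℤ in N variables x₀,…,x_{N-1},
-- represented as (unnormalised) lists of terms  c · x^α.

Monomial : ℕ → Set
Monomial N = Vec ℕ N

Poly : ℕ → Set
Poly N = List (ℤ × Monomial N)

unitMon : (N p : ℕ) → Monomial N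
unitMon zero    p       = []
unitMon (suc N) zero    = 1 ∷ replicate N 0
unitMon (suc N) (suc p) = 0 ∷ unitMon N p

mulMon : ∀ {N} → Monomial N → Monomial N → Monomial N
mulMon = zipWith _+_

mulLinDiff : ∀ {N} → ℕ → ℕ → Poly N → Poly N
mulLinDiff {N} p q P =
  concatMap (λ { (c , m) → (c , mulMon m (unitMon N p))
                         ∷ (- c , mulMon m (unitMon N q)) ∷ [] }) P

prodDiff : (N : ℕ) → List (ℕ × ℕ) → Poly N
prodDiff N []             = (ℤ⁺ 1 , replicate N 0) ∷ []
prodDiff N ((p , q) ∷ es) = mulLinDiff p q (prodDiff N es)

coeff : ∀ {N} → Poly N → Monomial N → ℤ
coeff []            α = ℤ⁺ 0
coeff ((c , m) ∷ P) α with VecP.≡-dec _≟_ m α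
... | yes _ = c +ℤ coeff P α
... | no  _ = coeff P α

-- The graph G of Theorem 5.16.
-- Vertex labels: v_j ↦ j (1 ≤ j ≤ k), u ↦ k+1, v ↦ k+2.
-- The variable of vertex with label ℓ is x_{ℓ-1}; there are k+2 variables.
-- Each edge is stored as (a , b) with a < b (label order
-- v₁ < v₂ < … < v_k < u < v), and contributes the factor (x_a − x_b).

range : ℕ → ℕ → List ℕ
range a b = map (a +_) (upTo (suc b ∸ a))

edgesG : (k i : ℕ) → List (ℕ × ℕ)
edgesG k i =
     map (λ j → (j , suc j)) (range 1 (k ∸ 1))
  ++ (1 , k) ∷ []
  ++ map (λ j → (j , k + 1)) (range 1 i)
  ++ (k + 1 , k + 2) ∷ []
  ++ map (λ j → (j , k + 2)) (range i k)
  ++ (1 , k + 2) ∷ []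

sameEdge : ℕ → ℕ → ℕ × ℕ → Bool
sameEdge a b (x , y) =
  (⌊ x ≟ a ⌋ ∧ ⌊ y ≟ b ⌋) ∨ (⌊ x ≟ b ⌋ ∧ ⌊ y ≟ a ⌋)

-- H − v_k v₁ v₂ : delete the edges v_k v₁ and v₁ v₂ (keep all vertices)
deletePath : (a b c : ℕ) → List (ℕ × ℕ) → List (ℕ × ℕ)
deletePath a b c [] = []
deletePath a b c (e ∷ es) with sameEdge a b e ∨ sameEdge b c e
... | true  = deletePath a b c es
... | false = e ∷ deletePath a b c es

graphPoly : (N : ℕ) → List (ℕ × ℕ) → Poly N
graphPoly N es = prodDiff N (map (λ { (a , b) → (a ∸ 1 , b ∸ 1) }) es)

expOf : ∀ {N} → Monomial N → ℕ → ℕ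
expOf α ℓ = go α (ℓ ∸ 1)
  where
  go : ∀ {n} → Vec ℕ n → ℕ → ℕ
  go []       _       = 0
  go (x ∷ xs) zero    = x
  go (x ∷ xs) (suc j) = go xs j

{-# OPTIONS --safe #-}

-- Expanding the factors (x_p − x_q) one at a time, a coefficient of ∏ (x_p − x_q) is a signed
-- sum over the ways of handing each edge to one of its ends; a branch dies as soon as some
-- vertex receives more than its exponent, or keeps an exponent that no remaining edge touches.
-- Take exponent 0 at v₁, v₂, v_k, exponent 2 at v₃, …, v_{k−1}, and α_u, α_v ∈ {3, 4}. The edges
-- at v₁, v₂, v_k are then forced, and along the path v₃ … v_{k−1} each vertex must take exactly
-- two of its edges, so the expansion runs through a two-state automaton (whether the vertex
-- already received the edge from its predecessor). The fan of u (v₃ … v_{i−1}), the junction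
-- v_i and the fan of v (v_{i+1} … v_{k−1}) give a closed form depending only on the parities of
-- i and k − i, and for one of (α_u, α_v) = (4, 3), (3, 4) it is nonzero.
module Submission where

open import Defs
open import Data.Nat using (ℕ; zero; suc; _+_; _∸_; _≤_; _<_; s≤s; z≤n; _≟_; _<?_)
import Data.Nat.Properties as ℕP
open import Data.Integer as ℤ using (ℤ; +_; -[1+_])
open import Data.Integer using () renaming (+_ to ℤ⁺)
import Data.Integer.Properties as ℤP
open import Data.Integer.Solver using (module +-*-Solver)
open import Data.Bool using (Bool; true; false; if_then_else_; _∧_; _∨_)
open import Data.Bool.Properties using (∧-zeroʳ; ∨-zeroʳ; if-float)
open import Data.List using (List; []; _∷_; _++_; drop; map; applyUpTo)
open import Data.List.Properties using (++-identityʳ; map-++; map-upTo; map-applyUpTo)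
open import Data.List.Relation.Unary.All using (All; []; _∷_)
import Data.List.Relation.Unary.All.Properties as All
open import Data.List.Relation.Binary.Permutation.Propositional as ↭ using (_↭_)
import Data.List.Relation.Binary.Permutation.Propositional.Properties as ↭ₚ
open import Data.Fin using (#_; toℕ)
open import Data.Vec using ([]; _∷_; replicate; tabulate)
import Data.Vec.Properties as VecP
open import Data.Product using (Σ; _×_; _,_; proj₁; proj₂)
open import Data.Sum using (_⊎_; inj₁; inj₂)
import Data.Sum
open import Algebra.Solver.CommutativeMonoid (↭ₚ.++-commutativeMonoid {A = ℕ × ℕ}) using (Expr; prove; _⊕_; var)
open import Data.Empty using (⊥-elim)
open import Function using (_∘_; case_of_)
open import Relation.Nullary using (¬_; Dec; yes; no; does)
open import Relation.Nullary.Decidable using (dec-true; dec-false; isYes; isYes≗does)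
open import Relation.Binary.PropositionalEquality
open import Relation.Binary.Definitions using (tri<; tri≈; tri>)

-- Coefficients of products of linear differences

Exponents : Set
Exponents = ℕ → ℤ

opaque
  δ : ℕ → ℕ → ℤ
  δ p x = + (if does (x ≟ p) then 1 else 0)

  _⊖_ : Exponents → ℕ → Exponents
  (f ⊖ p) x = f x ℤ.- δ p x

  infixl 6 _⊖_

allZero : ℕ → Exponents → Bool
allZero zero    f = true
allZero (suc N) f = does (f N ℤ.≟ + 0) ∧ allZero N f

-- The coefficient of x^f in ∏ (x_p − x_q) over the variables x₀ … x_{N−1}, computed by expanding
-- the first factor; exponents are integers so that lowering one below zero simply yields 0.
coeffDiff : ℕ → List (ℕ × ℕ) → Exponents → ℤ
coeffDiff N []             f = if allZero N f then + 1 else + 0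
coeffDiff N ((p , q) ∷ es) f = coeffDiff N es (f ⊖ p) ℤ.- coeffDiff N es (f ⊖ q)

opaque
  unfolding _⊖_

  ⊖-same : ∀ f p → (f ⊖ p) p ≡ f p ℤ.- + 1
  ⊖-same f p rewrite dec-true (p ≟ p) refl = refl

  ⊖-other : ∀ f {p x} → x ≢ p → (f ⊖ p) x ≡ f x
  ⊖-other f {p} {x} x≢p rewrite dec-false (x ≟ p) x≢p = ℤP.+-identityʳ (f x)

  ⊖-cong : ∀ {f g} p → f ≗ g → f ⊖ p ≗ g ⊖ p
  ⊖-cong p f≗g x = cong (ℤ._- δ p x) (f≗g x)

  ⊖-comm : ∀ f p q → f ⊖ p ⊖ q ≗ f ⊖ q ⊖ p
  ⊖-comm f p q x = begin
    f x ℤ.- δ p x ℤ.- δ q x     ≡⟨ ℤP.+-assoc (f x) _ _ ⟩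
    f x ℤ.+ (ℤ.- δ p x ℤ.- δ q x) ≡⟨ cong (λ z → f x ℤ.+ z) (ℤP.+-comm (ℤ.- δ p x) _) ⟩
    f x ℤ.+ (ℤ.- δ q x ℤ.- δ p x) ≡⟨ ℤP.+-assoc (f x) _ _ ⟨
    f x ℤ.- δ q x ℤ.- δ p x     ∎
    where open ≡-Reasoning

  ⊖-≤ : ∀ f p x → (f ⊖ p) x ℤ.≤ f x
  ⊖-≤ f p x =
    subst ((f ⊖ p) x ℤ.≤_) (ℤP.+-identityʳ (f x)) (ℤP.+-monoʳ-≤ (f x) (ℤP.neg-mono-≤ (ℤ.+≤+ z≤n)))

allZero-cong : ∀ N {f g} → f ≗ g → allZero N f ≡ allZero N g
allZero-cong zero    f≗g = refl
allZero-cong (suc N) f≗g = cong₂ (λ z b → does (z ℤ.≟ + 0) ∧ b) (f≗g N) (allZero-cong N f≗g)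

coeffDiff-cong : ∀ N es {f g} → f ≗ g → coeffDiff N es f ≡ coeffDiff N es g
coeffDiff-cong N []             f≗g = cong (if_then + 1 else + 0) (allZero-cong N f≗g)
coeffDiff-cong N ((p , q) ∷ es) f≗g =
  cong₂ ℤ._-_ (coeffDiff-cong N es (⊖-cong p f≗g)) (coeffDiff-cong N es (⊖-cong q f≗g))

coeffDiff-swap : ∀ N e e′ es f → coeffDiff N (e ∷ e′ ∷ es) f ≡ coeffDiff N (e′ ∷ e ∷ es) f
coeffDiff-swap N (p , q) (p′ , q′) es f =
  trans (cong₂ ℤ._-_ (cong₂ ℤ._-_ (swapped p p′) (swapped p q′))
                     (cong₂ ℤ._-_ (swapped q p′) (swapped q q′)))
        (solve 4 (λ a b c d → (a :- b) :- (c :- d) := (a :- c) :- (b :- d)) refl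
               (C (f ⊖ p′ ⊖ p)) (C (f ⊖ q′ ⊖ p)) (C (f ⊖ p′ ⊖ q)) (C (f ⊖ q′ ⊖ q)))
  where
  open +-*-Solver
  C : Exponents → ℤ
  C = coeffDiff N es
  swapped : ∀ a b → C (f ⊖ a ⊖ b) ≡ C (f ⊖ b ⊖ a)
  swapped a b = coeffDiff-cong N es (⊖-comm f a b)

coeffDiff-∷ : ∀ N e {xs ys} → (∀ f → coeffDiff N xs f ≡ coeffDiff N ys f) →
              ∀ f → coeffDiff N (e ∷ xs) f ≡ coeffDiff N (e ∷ ys) f
coeffDiff-∷ N (p , q) xs≈ys f = cong₂ ℤ._-_ (xs≈ys (f ⊖ p)) (xs≈ys (f ⊖ q))

coeffDiff-↭ : ∀ N {es fs} → es ↭ fs → ∀ f → coeffDiff N es f ≡ coeffDiff N fs f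
coeffDiff-↭ N ↭.refl                       f = refl
coeffDiff-↭ N (↭.prep {xs} {ys} e es↭fs)    f = coeffDiff-∷ N e {xs} {ys} (coeffDiff-↭ N es↭fs) f
coeffDiff-↭ N (↭.swap {xs} {ys} e e′ es↭fs) f =
  trans (coeffDiff-swap N e e′ xs f)
        (coeffDiff-∷ N e′ {e ∷ xs} {e ∷ ys} (coeffDiff-∷ N e {xs} {ys} (coeffDiff-↭ N es↭fs)) f)
coeffDiff-↭ N (↭.trans es↭gs gs↭fs)        f = trans (coeffDiff-↭ N es↭gs f) (coeffDiff-↭ N gs↭fs f)

Avoids : ℕ → List (ℕ × ℕ) → Set
Avoids x = All (λ e → x ≢ proj₁ e × x ≢ proj₂ e)

allZero-false : ∀ N f x → x < N → f x ≢ + 0 → allZero N f ≡ false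
allZero-false (suc N) f x x<1+N fx≢0 with x ≟ N
... | yes refl rewrite dec-false (f x ℤ.≟ + 0) fx≢0 = refl
... | no x≢N   rewrite allZero-false N f x (ℕP.≤∧≢⇒< (ℕP.≤-pred x<1+N) x≢N) fx≢0 = ∧-zeroʳ _

allZero-true : ∀ N f → (∀ x → x < N → f x ≡ + 0) → allZero N f ≡ true
allZero-true zero    f f≡0 = refl
allZero-true (suc N) f f≡0
  rewrite dec-true (f N ℤ.≟ + 0) (f≡0 N (ℕP.n<1+n N))
  = allZero-true N f (λ x x<N → f≡0 x (ℕP.m<n⇒m<1+n x<N))

allZero-sound : ∀ N f → allZero N f ≡ true → ∀ x → x < N → f x ≡ + 0
allZero-sound (suc N) f all0 x x<1+N with f N ℤ.≟ + 0
... | no _ = ⊥-elim (case all0 of λ ())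
... | yes fN≡0 with x ≟ N
...   | yes refl = fN≡0
...   | no x≢N   = allZero-sound N f all0 x (ℕP.≤∧≢⇒< (ℕP.≤-pred x<1+N) x≢N)

coeffDiff-negative : ∀ N es f x → x < N → f x ℤ.< + 0 → coeffDiff N es f ≡ + 0
coeffDiff-negative N [] f x x<N fx<0 rewrite allZero-false N f x x<N (ℤP.<⇒≢ fx<0) = refl
coeffDiff-negative N ((p , q) ∷ es) f x x<N fx<0
  rewrite coeffDiff-negative N es (f ⊖ p) x x<N (ℤP.≤-<-trans (⊖-≤ f p x) fx<0)
        | coeffDiff-negative N es (f ⊖ q) x x<N (ℤP.≤-<-trans (⊖-≤ f q x) fx<0) = refl

coeffDiff-avoided : ∀ N es f x → x < N → Avoids x es → f x ≢ + 0 → coeffDiff N es f ≡ + 0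
coeffDiff-avoided N [] f x x<N [] fx≢0 rewrite allZero-false N f x x<N fx≢0 = refl
coeffDiff-avoided N ((p , q) ∷ es) f x x<N ((x≢p , x≢q) ∷ avoids) fx≢0
  rewrite coeffDiff-avoided N es (f ⊖ p) x x<N avoids (fx≢0 ∘ trans (sym (⊖-other f x≢p)))
        | coeffDiff-avoided N es (f ⊖ q) x x<N avoids (fx≢0 ∘ trans (sym (⊖-other f x≢q))) = refl

coeffDiff-forced : ∀ N es f x y → x < N → f x ≡ + 0 →
                   coeffDiff N ((x , y) ∷ es) f ≡ ℤ.- coeffDiff N es (f ⊖ y)
coeffDiff-forced N es f x y x<N fx≡0 =
  trans (cong (ℤ._- coeffDiff N es (f ⊖ y)) (coeffDiff-negative N es (f ⊖ x) x x<N fx-1<0)) (ℤP.+-identityˡ _)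
  where
  fx-1<0 : (f ⊖ x) x ℤ.< + 0
  fx-1<0 = subst (ℤ._< + 0) (sym (trans (⊖-same f x) (cong (ℤ._- + 1) fx≡0))) ℤ.-<+

-- expOf counts vertex labels from 1, exponent vectors count variables from 0.
exponents : ∀ {N} → Monomial N → Exponents
exponents α x = + expOf α (suc x)

timesVar : ∀ {N} → ℕ → Poly N → Poly N
timesVar {N} p = map (Data.Product.map₂ (λ m → mulMon m (unitMon N p)))

lowerAt : ∀ {N} → Monomial N → ℕ → Monomial N
lowerAt []       _       = []
lowerAt (a ∷ α) zero    = (a ∸ 1) ∷ α
lowerAt (a ∷ α) (suc p) = a ∷ lowerAt α p

expOf-replicate : ∀ N x → expOf (replicate N 0) (suc x) ≡ 0
expOf-replicate zero    x       = refl
expOf-replicate (suc N) zero    = refl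
expOf-replicate (suc N) (suc x) = expOf-replicate N x

≡replicate : ∀ {N} (α : Monomial N) → (∀ x → x < N → expOf α (suc x) ≡ 0) → α ≡ replicate N 0
≡replicate []      α≡0 = refl
≡replicate (a ∷ α) α≡0 =
  cong₂ _∷_ (α≡0 0 (s≤s z≤n)) (≡replicate α (λ x x<N → α≡0 (suc x) (s≤s x<N)))

mulMon-identityʳ : ∀ {N} (m : Monomial N) → mulMon m (replicate N 0) ≡ m
mulMon-identityʳ = VecP.zipWith-identityʳ ℕP.+-identityʳ

expOf-timesVar : ∀ {N} (m : Monomial N) p → p < N →
                 expOf (mulMon m (unitMon N p)) (suc p) ≡ suc (expOf m (suc p))
expOf-timesVar (a ∷ m) zero    _         = ℕP.+-comm a 1
expOf-timesVar (a ∷ m) (suc p) (s≤s p<N) = expOf-timesVar m p p<N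

lowerAt-timesVar : ∀ {N} (m : Monomial N) p → p < N → lowerAt (mulMon m (unitMon N p)) p ≡ m
lowerAt-timesVar (a ∷ m) zero    _         = cong₂ _∷_ (ℕP.m+n∸n≡m a 1) (mulMon-identityʳ m)
lowerAt-timesVar (a ∷ m) (suc p) (s≤s p<N) = cong₂ _∷_ (ℕP.+-identityʳ a) (lowerAt-timesVar m p p<N)

timesVar-lowerAt : ∀ {N} (α : Monomial N) p {a} → expOf α (suc p) ≡ suc a →
                   mulMon (lowerAt α p) (unitMon N p) ≡ α
timesVar-lowerAt (b ∷ α) zero    {a} refl = cong₂ _∷_ (ℕP.+-comm a 1) (mulMon-identityʳ α)
timesVar-lowerAt (b ∷ α) (suc p) αp≡1+a   = cong₂ _∷_ (ℕP.+-identityʳ b) (timesVar-lowerAt α p αp≡1+a)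

expOf-lowerAt-same : ∀ {N} (α : Monomial N) p → expOf (lowerAt α p) (suc p) ≡ expOf α (suc p) ∸ 1
expOf-lowerAt-same []      p       = refl
expOf-lowerAt-same (a ∷ α) zero    = refl
expOf-lowerAt-same (a ∷ α) (suc p) = expOf-lowerAt-same α p

expOf-lowerAt-other : ∀ {N} (α : Monomial N) p x → x ≢ p →
                      expOf (lowerAt α p) (suc x) ≡ expOf α (suc x)
expOf-lowerAt-other []      p       x       x≢p = refl
expOf-lowerAt-other (a ∷ α) zero    zero    x≢p = ⊥-elim (x≢p refl)
expOf-lowerAt-other (a ∷ α) zero    (suc x) x≢p = refl
expOf-lowerAt-other (a ∷ α) (suc p) zero    x≢p = refl
expOf-lowerAt-other (a ∷ α) (suc p) (suc x) x≢p = expOf-lowerAt-other α p x (x≢p ∘ cong suc)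

exponents-lowerAt : ∀ {N} (α : Monomial N) p {a} → expOf α (suc p) ≡ suc a →
                    exponents (lowerAt α p) ≗ exponents α ⊖ p
exponents-lowerAt α p αp≡1+a x with x ≟ p
... | yes refl rewrite ⊖-same (exponents α) p | expOf-lowerAt-same α p | αp≡1+a = refl
... | no x≢p   rewrite ⊖-other (exponents α) x≢p = cong +_ (expOf-lowerAt-other α p x x≢p)

coeff-∷ : ∀ {N} c (m α : Monomial N) P → coeff ((c , m) ∷ P) α ≡ coeff ((c , m) ∷ []) α ℤ.+ coeff P α
coeff-∷ c m α P with VecP.≡-dec _≟_ m α
... | yes _ = cong (ℤ._+ coeff P α) (sym (ℤP.+-identityʳ c))
... | no  _ = sym (ℤP.+-identityˡ _)

coeff-neg : ∀ {N} c (m α : Monomial N) → coeff ((ℤ.- c , m) ∷ []) α ≡ ℤ.- coeff ((c , m) ∷ []) α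
coeff-neg c m α with VecP.≡-dec _≟_ m α
... | yes _ = trans (ℤP.+-identityʳ (ℤ.- c)) (cong ℤ.-_ (sym (ℤP.+-identityʳ c)))
... | no  _ = refl

coeff-mulLinDiff : ∀ {N} p q (P : Poly N) α →
                   coeff (mulLinDiff p q P) α ≡ coeff (timesVar p P) α ℤ.- coeff (timesVar q P) α
coeff-mulLinDiff p q []            α = refl
coeff-mulLinDiff {N} p q ((c , m) ∷ P) α = begin
  coeff ((c , mp) ∷ (ℤ.- c , mq) ∷ mulLinDiff p q P) α
    ≡⟨ coeff-∷ c mp α _ ⟩
  A ℤ.+ coeff ((ℤ.- c , mq) ∷ mulLinDiff p q P) α
    ≡⟨ cong (ℤ._+_ A) (coeff-∷ (ℤ.- c) mq α _) ⟩
  A ℤ.+ (coeff ((ℤ.- c , mq) ∷ []) α ℤ.+ coeff (mulLinDiff p q P) α)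
    ≡⟨ cong₂ (λ b r → A ℤ.+ (b ℤ.+ r)) (coeff-neg c mq α) (coeff-mulLinDiff p q P α) ⟩
  A ℤ.+ (ℤ.- B ℤ.+ (Sp ℤ.- Sq))
    ≡⟨ solve 4 (λ a b s t → a :+ (:- b :+ (s :- t)) := (a :+ s) :- (b :+ t)) refl A B Sp Sq ⟩
  (A ℤ.+ Sp) ℤ.- (B ℤ.+ Sq)
    ≡⟨ cong₂ ℤ._-_ (coeff-∷ c mp α _) (coeff-∷ c mq α _) ⟨
  coeff (timesVar p ((c , m) ∷ P)) α ℤ.- coeff (timesVar q ((c , m) ∷ P)) α ∎
  where
  open ≡-Reasoning
  open +-*-Solver
  mp mq : Monomial N
  mp = mulMon m (unitMon N p)
  mq = mulMon m (unitMon N q)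
  A B Sp Sq : ℤ
  A = coeff ((c , mp) ∷ []) α
  B = coeff ((c , mq) ∷ []) α
  Sp = coeff (timesVar p P) α
  Sq = coeff (timesVar q P) α

coeff-timesVar-zero : ∀ {N} (P : Poly N) α p → p < N → expOf α (suc p) ≡ 0 → coeff (timesVar p P) α ≡ + 0
coeff-timesVar-zero []            α p p<N αp≡0 = refl
coeff-timesVar-zero {N} ((c , m) ∷ P) α p p<N αp≡0 with VecP.≡-dec _≟_ (mulMon m (unitMon N p)) α
... | yes mp≡α = ⊥-elim (ℕP.1+n≢0 (trans (sym (expOf-timesVar m p p<N))
                                         (trans (cong (λ β → expOf β (suc p)) mp≡α) αp≡0)))
... | no  _    = coeff-timesVar-zero P α p p<N αp≡0

coeff-timesVar-suc : ∀ {N} (P : Poly N) α p {a} → p < N → expOf α (suc p) ≡ suc a →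
                     coeff (timesVar p P) α ≡ coeff P (lowerAt α p)
coeff-timesVar-suc []            α p p<N αp≡1+a = refl
coeff-timesVar-suc {N} ((c , m) ∷ P) α p p<N αp≡1+a
  with VecP.≡-dec _≟_ (mulMon m (unitMon N p)) α | VecP.≡-dec _≟_ m (lowerAt α p)
... | yes _    | yes _    = cong (ℤ._+_ c) (coeff-timesVar-suc P α p p<N αp≡1+a)
... | yes mp≡α | no  m≢α′ =
  ⊥-elim (m≢α′ (trans (sym (lowerAt-timesVar m p p<N)) (cong (λ β → lowerAt β p) mp≡α)))
... | no  mp≢α | yes m≡α′ =
  ⊥-elim (mp≢α (trans (cong (λ β → mulMon β (unitMon N p)) m≡α′) (timesVar-lowerAt α p αp≡1+a)))
... | no  _    | no  _    = coeff-timesVar-suc P α p p<N αp≡1+a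

coeff-timesVar : ∀ {N} (P : Poly N) es p → p < N → (∀ β → coeff P β ≡ coeffDiff N es (exponents β)) →
                 ∀ α → coeff (timesVar p P) α ≡ coeffDiff N es (exponents α ⊖ p)
coeff-timesVar {N} P es p p<N P≡ α with expOf α (suc p) in αp
... | zero  = trans (coeff-timesVar-zero P α p p<N αp) (sym (coeffDiff-negative N es _ p p<N αp-1<0))
  where
  αp-1<0 : (exponents α ⊖ p) p ℤ.< + 0
  αp-1<0 = subst (ℤ._< + 0) (sym (trans (⊖-same (exponents α) p) (cong (λ n → + n ℤ.- + 1) αp))) ℤ.-<+
... | suc a = trans (coeff-timesVar-suc P α p p<N αp)
                    (trans (P≡ (lowerAt α p)) (coeffDiff-cong N es (exponents-lowerAt α p αp)))

Bounded : ℕ → List (ℕ × ℕ) → Set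
Bounded N = All (λ e → proj₁ e < N × proj₂ e < N)

coeff-prodDiff : ∀ N es → Bounded N es → ∀ α → coeff (prodDiff N es) α ≡ coeffDiff N es (exponents α)
coeff-prodDiff N [] [] α with VecP.≡-dec _≟_ (replicate N 0) α | allZero N (exponents α) in all0
... | yes _    | true  = refl
... | yes refl | false = case trans (sym all0) (allZero-true N _ λ x _ → cong +_ (expOf-replicate N x)) of λ ()
... | no  0≢α  | true  =
  ⊥-elim (0≢α (sym (≡replicate α λ x x<N → ℤP.+-injective (allZero-sound N _ all0 x x<N))))
... | no  _    | false = refl
coeff-prodDiff N ((p , q) ∷ es) ((p<N , q<N) ∷ bounded) α =
  trans (coeff-mulLinDiff p q P α)
        (cong₂ ℤ._-_ (coeff-timesVar P es p p<N IH α) (coeff-timesVar P es q q<N IH α))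
  where
  P : Poly N
  P = prodDiff N es
  IH : ∀ β → coeff P β ≡ coeffDiff N es (exponents β)
  IH = coeff-prodDiff N es bounded

-- The sweep along the path

pathTarget : ℕ → ℕ → ℤ
pathTarget k x = if does (1 <? x) ∧ does (x <? k ∸ 1) then + 2 else + 0

-- The exponents still to be produced when the edges at the path vertices before x_p have been
-- expanded: those vertices are done, x_p has already received t of its edges, and the hubs
-- u = x_k and v = x_{k+1} still need U and V.
opaque
  sweep : (k t p : ℕ) (U V : ℤ) → Exponents
  sweep k t p U V x =
    if does (x <? p) then + 0 else
    if does (x ≟ p) then pathTarget k x ℤ.- + t else
    if does (x ≟ k) then U else
    if does (x ≟ suc k) then V else
    pathTarget k x

opaque
  unfolding sweep

  sweep-below : ∀ {k t p U V x} → x < p → sweep k t p U V x ≡ + 0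
  sweep-below {p = p} {x = x} x<p rewrite dec-true (x <? p) x<p = refl

  sweep-here : ∀ {k t p U V} → sweep k t p U V p ≡ pathTarget k p ℤ.- + t
  sweep-here {p = p} rewrite dec-false (p <? p) (ℕP.n≮n p) | dec-true (p ≟ p) refl = refl

  sweep-u : ∀ {k t p U V} → p < k → sweep k t p U V k ≡ U
  sweep-u {k} {p = p} p<k
    rewrite dec-false (k <? p) (ℕP.<⇒≯ p<k) | dec-false (k ≟ p) (ℕP.>⇒≢ p<k) | dec-true (k ≟ k) refl = refl

  sweep-v : ∀ {k t p U V} → p < k → sweep k t p U V (suc k) ≡ V
  sweep-v {k} {p = p} p<k
    rewrite dec-false (suc k <? p) (ℕP.<⇒≯ (ℕP.m<n⇒m<1+n p<k))
          | dec-false (suc k ≟ p) (ℕP.>⇒≢ (ℕP.m<n⇒m<1+n p<k))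
          | dec-false (suc k ≟ k) ℕP.1+n≢n | dec-true (suc k ≟ suc k) refl = refl

  sweep-above : ∀ {k t p U V x} → p < x → x ≢ k → x ≢ suc k → sweep k t p U V x ≡ pathTarget k x
  sweep-above {k} {p = p} {x = x} p<x x≢k x≢1+k
    rewrite dec-false (x <? p) (ℕP.<⇒≯ p<x) | dec-false (x ≟ p) (ℕP.>⇒≢ p<x)
          | dec-false (x ≟ k) x≢k | dec-false (x ≟ suc k) x≢1+k = refl

sweep-elsewhere : ∀ {k t t′ p U U′ V V′} x → x ≢ p → x ≢ k → x ≢ suc k →
                  sweep k t p U V x ≡ sweep k t′ p U′ V′ x
sweep-elsewhere {p = p} x x≢p x≢k x≢1+k with ℕP.<-cmp x p
... | tri< x<p _ _ = trans (sweep-below x<p) (sym (sweep-below x<p))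
... | tri≈ _ x≡p _ = ⊥-elim (x≢p x≡p)
... | tri> _ _ p<x = trans (sweep-above p<x x≢k x≢1+k) (sym (sweep-above p<x x≢k x≢1+k))

sweep-⊖u : ∀ k t p U V → p < k → sweep k t p U V ⊖ k ≗ sweep k t p (U ℤ.- + 1) V
sweep-⊖u k t p U V p<k x with x ≟ k | x ≟ suc k | x ≟ p
... | yes refl | _        | _        =
  trans (⊖-same (sweep k t p U V) k) (trans (cong (ℤ._- + 1) (sweep-u p<k)) (sym (sweep-u p<k)))
... | no x≢k   | yes refl | _        = trans (⊖-other (sweep k t p U V) x≢k) (trans (sweep-v p<k) (sym (sweep-v p<k)))
... | no x≢k   | no _     | yes refl = trans (⊖-other (sweep k t p U V) x≢k) (trans sweep-here (sym sweep-here))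
... | no x≢k   | no x≢1+k | no x≢p   = trans (⊖-other (sweep k t p U V) x≢k) (sweep-elsewhere x x≢p x≢k x≢1+k)

sweep-⊖v : ∀ k t p U V → p < k → sweep k t p U V ⊖ suc k ≗ sweep k t p U (V ℤ.- + 1)
sweep-⊖v k t p U V p<k x with x ≟ suc k | x ≟ k | x ≟ p
... | yes refl | _        | _        =
  trans (⊖-same (sweep k t p U V) (suc k)) (trans (cong (ℤ._- + 1) (sweep-v p<k)) (sym (sweep-v p<k)))
... | no x≢1+k | yes refl | _        = trans (⊖-other (sweep k t p U V) x≢1+k) (trans (sweep-u p<k) (sym (sweep-u p<k)))
... | no x≢1+k | no _     | yes refl = trans (⊖-other (sweep k t p U V) x≢1+k) (trans sweep-here (sym sweep-here))
... | no x≢1+k | no x≢k   | no x≢p   = trans (⊖-other (sweep k t p U V) x≢1+k) (sweep-elsewhere x x≢p x≢k x≢1+k)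

sweep-⊖here : ∀ k t p U V → p < k → sweep k t p U V ⊖ p ≗ sweep k (suc t) p U V
sweep-⊖here k t p U V p<k x with x ≟ p | x ≟ k | x ≟ suc k
... | yes refl | _        | _        = trans (⊖-same (sweep k t p U V) p) (trans (cong (ℤ._- + 1) sweep-here) lower)
  where
  lower : pathTarget k p ℤ.- + t ℤ.- + 1 ≡ sweep k (suc t) p U V p
  lower = trans (solve 2 (λ b s → b :- s :- con (+ 1) := b :- (con (+ 1) :+ s)) refl (pathTarget k p) (+ t))
                (sym sweep-here)
    where open +-*-Solver
... | no x≢p   | yes refl | _        = trans (⊖-other (sweep k t p U V) x≢p) (trans (sweep-u p<k) (sym (sweep-u p<k)))
... | no x≢p   | no _     | yes refl = trans (⊖-other (sweep k t p U V) x≢p) (trans (sweep-v p<k) (sym (sweep-v p<k)))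
... | no x≢p   | no x≢k   | no x≢1+k = trans (⊖-other (sweep k t p U V) x≢p) (sweep-elsewhere x x≢p x≢k x≢1+k)

sweep-advance : ∀ k t p U V → suc p < k → pathTarget k p ℤ.- + t ≡ + 0 →
                sweep k t p U V ≗ sweep k 0 (suc p) U V
sweep-advance k t p U V p+1<k settled x with ℕP.<-cmp x p
... | tri< x<p _ _  = trans (sweep-below x<p) (sym (sweep-below (ℕP.m<n⇒m<1+n x<p)))
... | tri≈ _ refl _ = trans sweep-here (trans settled (sym (sweep-below (ℕP.n<1+n p))))
... | tri> _ _ p<x with x ≟ k | x ≟ suc k
...   | yes refl | _        = trans (sweep-u (ℕP.<-trans (ℕP.n<1+n p) p+1<k)) (sym (sweep-u p+1<k))
...   | no _     | yes refl = trans (sweep-v (ℕP.<-trans (ℕP.n<1+n p) p+1<k)) (sym (sweep-v p+1<k))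
...   | no x≢k   | no x≢1+k with x ≟ suc p
...     | yes refl = trans (sweep-above p<x x≢k x≢1+k) (trans (sym (ℤP.+-identityʳ _)) (sym sweep-here))
...     | no x≢p+1 = trans (sweep-above p<x x≢k x≢1+k)
                           (sym (sweep-above (ℕP.≤∧≢⇒< p<x (x≢p+1 ∘ sym)) x≢k x≢1+k))

_⟫_ : {f g h : Exponents} → f ≗ g → g ≗ h → f ≗ h
(f≗g ⟫ g≗h) x = trans (f≗g x) (g≗h x)

infixr 5 _⟫_

2-t≢0 : ∀ {t} → t ≢ 2 → + 2 ℤ.- + t ≢ + 0
2-t≢0 {t} t≢2 = t≢2 ∘ sym ∘ ℤP.+-injective ∘ ℤP.i-j≡0⇒i≡j (+ 2) (+ t)

-- Expanding the edges at an inner vertex x_p, every branch either leaves x_p with a nonzero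
-- exponent, which the remaining edges cannot remove (stuck), or uses it up exactly (settled)
-- and moves on to x_{p+1}; an edge x_p x_{p+1} taken by x_{p+1} is carried along as ⊖ suc p.
module AtVertex (k p : ℕ) (rest : List (ℕ × ℕ)) (1<p : 1 < p) (p+1<k : suc p < k) (avoid : Avoids p rest) where

  N : ℕ
  N = k + 2

  C : Exponents → ℤ
  C = coeffDiff N rest

  p<k : p < k
  p<k = ℕP.<-trans (ℕP.n<1+n p) p+1<k

  p<N : p < N
  p<N = ℕP.<-≤-trans p<k (ℕP.m≤m+n k 2)

  target≡2 : pathTarget k p ≡ + 2
  target≡2 rewrite dec-true (1 <? p) 1<p | dec-true (p <? k ∸ 1) (ℕP.∸-monoˡ-≤ 1 p+1<k) = refl

  demand : ∀ {t U V} → sweep k t p U V p ≡ + 2 ℤ.- + t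
  demand {t} = trans sweep-here (cong (ℤ._- + t) target≡2)

  via : ∀ {f g z} → f ≗ g → C g ≡ z → C f ≡ z
  via f≗g = trans (coeffDiff-cong N rest f≗g)

  stuck : ∀ {t} U V → t ≢ 2 → C (sweep k t p U V) ≡ + 0
  stuck U V t≢2 = coeffDiff-avoided N rest _ p p<N avoid (2-t≢0 t≢2 ∘ trans (sym demand))

  stuck-next : ∀ {t} U V → t ≢ 2 → C (sweep k t p U V ⊖ suc p) ≡ + 0
  stuck-next {t} U V t≢2 = coeffDiff-avoided N rest _ p p<N avoid
    (2-t≢0 t≢2 ∘ trans (sym demand) ∘ trans (sym (⊖-other (sweep k t p U V) (ℕP.<⇒≢ (ℕP.n<1+n p)))))

  settle : ∀ U V → sweep k 2 p U V ≗ sweep k 0 (suc p) U V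
  settle U V = sweep-advance k 2 p U V p+1<k (cong (ℤ._- + 2) target≡2)

  settled : ∀ U V → C (sweep k 2 p U V) ≡ C (sweep k 0 (suc p) U V)
  settled U V = via (settle U V) refl

  settled-next : ∀ U V → C (sweep k 2 p U V ⊖ suc p) ≡ C (sweep k 1 (suc p) U V)
  settled-next U V = via (⊖-cong (suc p) (settle U V) ⟫ sweep-⊖here k 0 (suc p) U V p+1<k) refl

  ⊖here : ∀ t U V → sweep k t p U V ⊖ p ≗ sweep k (suc t) p U V
  ⊖here t U V = sweep-⊖here k t p U V p<k

  ⊖u : ∀ t U V → sweep k t p U V ⊖ k ≗ sweep k t p (U ℤ.- + 1) V
  ⊖u t U V = sweep-⊖u k t p U V p<k

  ⊖v : ∀ t U V → sweep k t p U V ⊖ suc k ≗ sweep k t p U (V ℤ.- + 1)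
  ⊖v t U V = sweep-⊖v k t p U V p<k

  next-last : ∀ f a b → f ⊖ suc p ⊖ a ⊖ b ≗ f ⊖ a ⊖ b ⊖ suc p
  next-last f a b = ⊖-cong b (⊖-comm f (suc p) a) ⟫ ⊖-comm (f ⊖ a) (suc p) b

  module _ (w : ℕ) (U V U′ V′ : ℤ) (⊖w : ∀ t → sweep k t p U V ⊖ w ≗ sweep k t p U′ V′) where

    path-step₀ : coeffDiff N ((p , suc p) ∷ (p , w) ∷ rest) (sweep k 0 p U V) ≡ C (sweep k 0 (suc p) U V)
    path-step₀ = begin
      (C (f ⊖ p ⊖ p) ℤ.- C (f ⊖ p ⊖ w)) ℤ.- (C (f ⊖ suc p ⊖ p) ℤ.- C (f ⊖ suc p ⊖ w))
        ≡⟨ cong₂ ℤ._-_ (cong₂ ℤ._-_ here-here here-hub) (cong₂ ℤ._-_ next-here next-hub) ⟩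
      (X ℤ.- + 0) ℤ.- (+ 0 ℤ.- + 0)
        ≡⟨ solve 1 (λ x → (x :- con (+ 0)) :- (con (+ 0) :- con (+ 0)) := x) refl X ⟩
      X ∎
      where
      open ≡-Reasoning
      open +-*-Solver
      f : Exponents
      f = sweep k 0 p U V
      X : ℤ
      X = C (sweep k 0 (suc p) U V)
      here-here : C (f ⊖ p ⊖ p) ≡ X
      here-here = via (⊖-cong p (⊖here 0 U V) ⟫ ⊖here 1 U V) (settled U V)
      here-hub : C (f ⊖ p ⊖ w) ≡ + 0
      here-hub = via (⊖-cong w (⊖here 0 U V) ⟫ ⊖w 1) (stuck U′ V′ λ ())
      next-here : C (f ⊖ suc p ⊖ p) ≡ + 0
      next-here = via (⊖-comm f (suc p) p ⟫ ⊖-cong (suc p) (⊖here 0 U V)) (stuck-next U V λ ())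
      next-hub : C (f ⊖ suc p ⊖ w) ≡ + 0
      next-hub = via (⊖-comm f (suc p) w ⟫ ⊖-cong (suc p) (⊖w 0)) (stuck-next U′ V′ λ ())

    path-step₁ : coeffDiff N ((p , suc p) ∷ (p , w) ∷ rest) (sweep k 1 p U V)
               ≡ ℤ.- C (sweep k 0 (suc p) U′ V′) ℤ.- C (sweep k 1 (suc p) U V)
    path-step₁ = begin
      (C (f ⊖ p ⊖ p) ℤ.- C (f ⊖ p ⊖ w)) ℤ.- (C (f ⊖ suc p ⊖ p) ℤ.- C (f ⊖ suc p ⊖ w))
        ≡⟨ cong₂ ℤ._-_ (cong₂ ℤ._-_ here-here here-hub) (cong₂ ℤ._-_ next-here next-hub) ⟩
      (+ 0 ℤ.- X) ℤ.- (Y ℤ.- + 0)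
        ≡⟨ solve 2 (λ x y → (con (+ 0) :- x) :- (y :- con (+ 0)) := :- x :- y) refl X Y ⟩
      ℤ.- X ℤ.- Y ∎
      where
      open ≡-Reasoning
      open +-*-Solver
      f : Exponents
      f = sweep k 1 p U V
      X Y : ℤ
      X = C (sweep k 0 (suc p) U′ V′)
      Y = C (sweep k 1 (suc p) U V)
      here-here : C (f ⊖ p ⊖ p) ≡ + 0
      here-here = via (⊖-cong p (⊖here 1 U V) ⟫ ⊖here 2 U V) (stuck U V λ ())
      here-hub : C (f ⊖ p ⊖ w) ≡ X
      here-hub = via (⊖-cong w (⊖here 1 U V) ⟫ ⊖w 2) (settled U′ V′)
      next-here : C (f ⊖ suc p ⊖ p) ≡ Y
      next-here = via (⊖-comm f (suc p) p ⟫ ⊖-cong (suc p) (⊖here 1 U V)) (settled-next U V)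
      next-hub : C (f ⊖ suc p ⊖ w) ≡ + 0
      next-hub = via (⊖-comm f (suc p) w ⟫ ⊖-cong (suc p) (⊖w 1)) (stuck-next U′ V′ λ ())

  module _ (U V : ℤ) where

    private
      U₁ V₁ : ℤ
      U₁ = U ℤ.- + 1
      V₁ = V ℤ.- + 1
      junction : Exponents → ℤ
      junction = coeffDiff N ((p , suc p) ∷ (p , k) ∷ (p , suc k) ∷ rest)

    junction-step₀ : junction (sweep k 0 p U V)
                   ≡ ℤ.- C (sweep k 0 (suc p) U V₁) ℤ.- C (sweep k 0 (suc p) U₁ V)
                     ℤ.- C (sweep k 1 (suc p) U V)
    junction-step₀ = begin
      ((C (f ⊖ p ⊖ p ⊖ p) ℤ.- C (f ⊖ p ⊖ p ⊖ suc k))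
       ℤ.- (C (f ⊖ p ⊖ k ⊖ p) ℤ.- C (f ⊖ p ⊖ k ⊖ suc k)))
      ℤ.- ((C (f ⊖ suc p ⊖ p ⊖ p) ℤ.- C (f ⊖ suc p ⊖ p ⊖ suc k))
           ℤ.- (C (f ⊖ suc p ⊖ k ⊖ p) ℤ.- C (f ⊖ suc p ⊖ k ⊖ suc k)))
        ≡⟨ cong₂ ℤ._-_ (cong₂ ℤ._-_ (cong₂ ℤ._-_ ppp pp-v) (cong₂ ℤ._-_ pu-p pu-v))
                       (cong₂ ℤ._-_ (cong₂ ℤ._-_ np-p np-v) (cong₂ ℤ._-_ nu-p nu-v)) ⟩
      ((+ 0 ℤ.- X) ℤ.- (Y ℤ.- + 0)) ℤ.- ((Z ℤ.- + 0) ℤ.- (+ 0 ℤ.- + 0))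
        ≡⟨ solve 3 (λ x y z → ((con (+ 0) :- x) :- (y :- con (+ 0)))
                              :- ((z :- con (+ 0)) :- (con (+ 0) :- con (+ 0)))
                              := :- x :- y :- z) refl X Y Z ⟩
      ℤ.- X ℤ.- Y ℤ.- Z ∎
      where
      open ≡-Reasoning
      open +-*-Solver
      f : Exponents
      f = sweep k 0 p U V
      X Y Z : ℤ
      X = C (sweep k 0 (suc p) U V₁)
      Y = C (sweep k 0 (suc p) U₁ V)
      Z = C (sweep k 1 (suc p) U V)
      ppp : C (f ⊖ p ⊖ p ⊖ p) ≡ + 0
      ppp = via (⊖-cong p (⊖-cong p (⊖here 0 U V) ⟫ ⊖here 1 U V) ⟫ ⊖here 2 U V) (stuck U V λ ())
      pp-v : C (f ⊖ p ⊖ p ⊖ suc k) ≡ X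
      pp-v = via (⊖-cong (suc k) (⊖-cong p (⊖here 0 U V) ⟫ ⊖here 1 U V) ⟫ ⊖v 2 U V) (settled U V₁)
      pu-p : C (f ⊖ p ⊖ k ⊖ p) ≡ Y
      pu-p = via (⊖-cong p (⊖-cong k (⊖here 0 U V) ⟫ ⊖u 1 U V) ⟫ ⊖here 1 U₁ V) (settled U₁ V)
      pu-v : C (f ⊖ p ⊖ k ⊖ suc k) ≡ + 0
      pu-v = via (⊖-cong (suc k) (⊖-cong k (⊖here 0 U V) ⟫ ⊖u 1 U V) ⟫ ⊖v 1 U₁ V) (stuck U₁ V₁ λ ())
      np-p : C (f ⊖ suc p ⊖ p ⊖ p) ≡ Z
      np-p = via (next-last f p p ⟫ ⊖-cong (suc p) (⊖-cong p (⊖here 0 U V) ⟫ ⊖here 1 U V))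
                 (settled-next U V)
      np-v : C (f ⊖ suc p ⊖ p ⊖ suc k) ≡ + 0
      np-v = via (next-last f p (suc k) ⟫ ⊖-cong (suc p) (⊖-cong (suc k) (⊖here 0 U V) ⟫ ⊖v 1 U V))
                 (stuck-next U V₁ λ ())
      nu-p : C (f ⊖ suc p ⊖ k ⊖ p) ≡ + 0
      nu-p = via (next-last f k p ⟫ ⊖-cong (suc p) (⊖-cong p (⊖u 0 U V) ⟫ ⊖here 0 U₁ V))
                 (stuck-next U₁ V λ ())
      nu-v : C (f ⊖ suc p ⊖ k ⊖ suc k) ≡ + 0
      nu-v = via (next-last f k (suc k) ⟫ ⊖-cong (suc p) (⊖-cong (suc k) (⊖u 0 U V) ⟫ ⊖v 0 U₁ V))
                 (stuck-next U₁ V₁ λ ())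

    junction-step₁ : junction (sweep k 1 p U V)
                   ≡ C (sweep k 0 (suc p) U₁ V₁) ℤ.+ C (sweep k 1 (suc p) U V₁)
                     ℤ.+ C (sweep k 1 (suc p) U₁ V)
    junction-step₁ = begin
      ((C (f ⊖ p ⊖ p ⊖ p) ℤ.- C (f ⊖ p ⊖ p ⊖ suc k))
       ℤ.- (C (f ⊖ p ⊖ k ⊖ p) ℤ.- C (f ⊖ p ⊖ k ⊖ suc k)))
      ℤ.- ((C (f ⊖ suc p ⊖ p ⊖ p) ℤ.- C (f ⊖ suc p ⊖ p ⊖ suc k))
           ℤ.- (C (f ⊖ suc p ⊖ k ⊖ p) ℤ.- C (f ⊖ suc p ⊖ k ⊖ suc k)))
        ≡⟨ cong₂ ℤ._-_ (cong₂ ℤ._-_ (cong₂ ℤ._-_ ppp pp-v) (cong₂ ℤ._-_ pu-p pu-v))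
                       (cong₂ ℤ._-_ (cong₂ ℤ._-_ np-p np-v) (cong₂ ℤ._-_ nu-p nu-v)) ⟩
      ((+ 0 ℤ.- + 0) ℤ.- (+ 0 ℤ.- X)) ℤ.- ((+ 0 ℤ.- Y) ℤ.- (Z ℤ.- + 0))
        ≡⟨ solve 3 (λ x y z → ((con (+ 0) :- con (+ 0)) :- (con (+ 0) :- x))
                              :- ((con (+ 0) :- y) :- (z :- con (+ 0)))
                              := x :+ y :+ z) refl X Y Z ⟩
      X ℤ.+ Y ℤ.+ Z ∎
      where
      open ≡-Reasoning
      open +-*-Solver
      f : Exponents
      f = sweep k 1 p U V
      X Y Z : ℤ
      X = C (sweep k 0 (suc p) U₁ V₁)
      Y = C (sweep k 1 (suc p) U V₁)
      Z = C (sweep k 1 (suc p) U₁ V)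
      ppp : C (f ⊖ p ⊖ p ⊖ p) ≡ + 0
      ppp = via (⊖-cong p (⊖-cong p (⊖here 1 U V) ⟫ ⊖here 2 U V) ⟫ ⊖here 3 U V) (stuck U V λ ())
      pp-v : C (f ⊖ p ⊖ p ⊖ suc k) ≡ + 0
      pp-v = via (⊖-cong (suc k) (⊖-cong p (⊖here 1 U V) ⟫ ⊖here 2 U V) ⟫ ⊖v 3 U V) (stuck U V₁ λ ())
      pu-p : C (f ⊖ p ⊖ k ⊖ p) ≡ + 0
      pu-p = via (⊖-cong p (⊖-cong k (⊖here 1 U V) ⟫ ⊖u 2 U V) ⟫ ⊖here 2 U₁ V) (stuck U₁ V λ ())
      pu-v : C (f ⊖ p ⊖ k ⊖ suc k) ≡ X
      pu-v = via (⊖-cong (suc k) (⊖-cong k (⊖here 1 U V) ⟫ ⊖u 2 U V) ⟫ ⊖v 2 U₁ V) (settled U₁ V₁)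
      np-p : C (f ⊖ suc p ⊖ p ⊖ p) ≡ + 0
      np-p = via (next-last f p p ⟫ ⊖-cong (suc p) (⊖-cong p (⊖here 1 U V) ⟫ ⊖here 2 U V))
                 (stuck-next U V λ ())
      np-v : C (f ⊖ suc p ⊖ p ⊖ suc k) ≡ Y
      np-v = via (next-last f p (suc k) ⟫ ⊖-cong (suc p) (⊖-cong (suc k) (⊖here 1 U V) ⟫ ⊖v 2 U V))
                 (settled-next U V₁)
      nu-p : C (f ⊖ suc p ⊖ k ⊖ p) ≡ Z
      nu-p = via (next-last f k p ⟫ ⊖-cong (suc p) (⊖-cong p (⊖u 1 U V) ⟫ ⊖here 1 U₁ V))
                 (settled-next U₁ V)
      nu-v : C (f ⊖ suc p ⊖ k ⊖ suc k) ≡ + 0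
      nu-v = via (next-last f k (suc k) ⟫ ⊖-cong (suc p) (⊖-cong (suc k) (⊖u 1 U V) ⟫ ⊖v 1 U₁ V))
                 (stuck-next U₁ V₁ λ ())

-- Fans, and the coefficient for G

fan : ℕ → ℕ → ℕ → List (ℕ × ℕ)
fan w p zero    = []
fan w p (suc n) = (p , suc p) ∷ (p , w) ∷ fan w (suc p) n

fan-avoids : ∀ {x} w p n → x < p → x < w → Avoids x (fan w p n)
fan-avoids w p zero    x<p x<w = []
fan-avoids w p (suc n) x<p x<w =
  (ℕP.<⇒≢ x<p , ℕP.<⇒≢ (ℕP.m<n⇒m<1+n x<p)) ∷ (ℕP.<⇒≢ x<p , ℕP.<⇒≢ x<w)
  ∷ fan-avoids w (suc p) n (ℕP.m<n⇒m<1+n x<p) x<w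

fan-bounded : ∀ {N} w s n → w < N → s + n < N → Bounded N (fan w s n)
fan-bounded w s zero    w<N s+n<N = []
fan-bounded {N} w s (suc n) w<N s+n<N =
  (s<N , s+1<N) ∷ (s<N , w<N) ∷ fan-bounded w (suc s) n w<N (subst (_< N) (ℕP.+-suc s n) s+n<N)
  where
  s+1<N : suc s < N
  s+1<N = ℕP.≤-<-trans (subst (suc s ≤_) (sym (ℕP.+-suc s n)) (s≤s (ℕP.m≤m+n s n))) s+n<N
  s<N : s < N
  s<N = ℕP.<-trans (ℕP.n<1+n s) s+1<N

-- Entering a fan of n vertices in state t = 1, the surplus edge is either passed along the whole
-- fan, with sign (−1)ⁿ, or absorbed by the hub at one of its vertices, with total coefficient
-- leak n = −[n odd].
sign : ℕ → ℤ
sign zero    = + 1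
sign (suc n) = ℤ.- sign n

leak : ℕ → ℤ
leak zero    = + 0
leak (suc n) = ℤ.- + 1 ℤ.- leak n

module Fan (k w : ℕ) (k≤w : k ≤ w) (U′ V′ : ℤ → ℤ → ℤ)
           (⊖w : ∀ t p U V → p < k → sweep k t p U V ⊖ w ≗ sweep k t p (U′ U V) (V′ U V)) where

  N : ℕ
  N = k + 2

  private
    module Head (n p : ℕ) (1<p : 1 < p) (p+n<k : suc p + n < k) (rest : List (ℕ × ℕ))
                (avoid : ∀ x → p ≤ x → x < suc p + n → Avoids x rest) where
      p+1<k : suc p < k
      p+1<k = ℕP.≤-<-trans (s≤s (ℕP.m≤m+n p n)) p+n<k

      open AtVertex k p (fan w (suc p) n ++ rest) 1<p p+1<k
        (All.++⁺ (fan-avoids w (suc p) n (ℕP.n<1+n p) (ℕP.<-≤-trans (ℕP.<-trans (ℕP.n<1+n p) p+1<k) k≤w))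
                 (avoid p ℕP.≤-refl (s≤s (ℕP.m≤m+n p n))))
        public using (C; p<k; path-step₀; path-step₁)

      avoid-tail : ∀ x → suc p ≤ x → x < suc p + n → Avoids x rest
      avoid-tail x p<x = avoid x (ℕP.<⇒≤ p<x)

  fan-sweep₀ : ∀ n p → 1 < p → p + n < k →
               ∀ rest → (∀ x → p ≤ x → x < p + n → Avoids x rest) → ∀ U V →
               coeffDiff N (fan w p n ++ rest) (sweep k 0 p U V) ≡ coeffDiff N rest (sweep k 0 (p + n) U V)
  fan-sweep₀ zero    p _   _     rest _     U V rewrite ℕP.+-identityʳ p = refl
  fan-sweep₀ (suc n) p 1<p p+n<k rest avoid U V rewrite ℕP.+-suc p n =
    trans (path-step₀ w U V (U′ U V) (V′ U V) (λ t → ⊖w t p U V p<k))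
          (fan-sweep₀ n (suc p) (ℕP.m<n⇒m<1+n 1<p) p+n<k rest avoid-tail U V)
    where open Head n p 1<p p+n<k rest avoid

  fan-sweep₁ : ∀ n p → 1 < p → p + n < k →
               ∀ rest → (∀ x → p ≤ x → x < p + n → Avoids x rest) → ∀ U V →
               coeffDiff N (fan w p n ++ rest) (sweep k 1 p U V)
               ≡ sign n ℤ.* coeffDiff N rest (sweep k 1 (p + n) U V)
                 ℤ.+ leak n ℤ.* coeffDiff N rest (sweep k 0 (p + n) (U′ U V) (V′ U V))
  fan-sweep₁ zero    p _   _     rest _     U V rewrite ℕP.+-identityʳ p =
    solve 2 (λ y x → y := con (+ 1) :* y :+ con (+ 0) :* x) refl
            (coeffDiff N rest (sweep k 1 p U V)) (coeffDiff N rest (sweep k 0 p (U′ U V) (V′ U V)))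
    where open +-*-Solver
  fan-sweep₁ (suc n) p 1<p p+n<k rest avoid U V rewrite ℕP.+-suc p n = begin
    coeffDiff N (fan w p (suc n) ++ rest) (sweep k 1 p U V)
      ≡⟨ path-step₁ w U V (U′ U V) (V′ U V) (λ t → ⊖w t p U V p<k) ⟩
    ℤ.- C (sweep k 0 (suc p) (U′ U V) (V′ U V)) ℤ.- C (sweep k 1 (suc p) U V)
      ≡⟨ cong₂ (λ a b → ℤ.- a ℤ.- b) (fan-sweep₀ n (suc p) 1<p+1 p+n<k rest avoid-tail (U′ U V) (V′ U V))
                                      (fan-sweep₁ n (suc p) 1<p+1 p+n<k rest avoid-tail U V) ⟩
    ℤ.- X ℤ.- (sign n ℤ.* Y ℤ.+ leak n ℤ.* X)
      ≡⟨ solve 4 (λ x y s l → :- x :- (s :* y :+ l :* x) := (:- s) :* y :+ (:- con (+ 1) :- l) :* x) refl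
                 X Y (sign n) (leak n) ⟩
    sign (suc n) ℤ.* Y ℤ.+ leak (suc n) ℤ.* X ∎
    where
    open Head n p 1<p p+n<k rest avoid
    open ≡-Reasoning
    open +-*-Solver
    1<p+1 : 1 < suc p
    1<p+1 = ℕP.m<n⇒m<1+n 1<p
    X Y : ℤ
    X = coeffDiff N rest (sweep k 0 (suc (p + n)) (U′ U V) (V′ U V))
    Y = coeffDiff N rest (sweep k 1 (suc (p + n)) U V)

hubsEmpty : ℤ → ℤ → ℤ
hubsEmpty X Y = if does (X ℤ.≟ + 0) ∧ does (Y ℤ.≟ + 0) then + 1 else + 0

-- G with i = 3 + a and k = 4 + a + b, in variable indices: v_j is x_{j−1}, u is x_k and v is
-- x_{k+1}; c is the index of v_i and last that of v_k.
module Evaluation (a b : ℕ) where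

  k N c last : ℕ
  k = 4 + a + b
  N = k + 2
  c = 2 + a
  last = k ∸ 1

  2<k : 2 < k
  2<k = s≤s (s≤s (s≤s z≤n))

  last<k : last < k
  last<k = ℕP.n<1+n last

  k<N : k < N
  k<N = ℕP.≤-trans (ℕP.n≤1+n _) (ℕP.≤-reflexive (ℕP.+-comm 2 k))

  k+1<N : suc k < N
  k+1<N = ℕP.≤-reflexive (ℕP.+-comm 2 k)

  last<N : last < N
  last<N = ℕP.<-trans last<k k<N

  c+1<k : suc c < k
  c+1<k = s≤s (s≤s (s≤s (s≤s (ℕP.m≤m+n a b))))

  last-target : pathTarget k last ≡ + 0
  last-target rewrite dec-false (last <? last) (ℕP.n≮n last) =
    cong (if_then + 2 else + 0) (∧-zeroʳ (does (1 <? last)))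

  end₀ : ∀ X Y → coeffDiff N [] (sweep k 0 last X Y) ≡ hubsEmpty X Y
  end₀ X Y with X ℤ.≟ + 0 | Y ℤ.≟ + 0
  ... | yes X≡0 | yes Y≡0 = cong (if_then + 1 else + 0) (allZero-true N _ vanishes)
    where
    vanishes : ∀ x → x < N → sweep k 0 last X Y x ≡ + 0
    vanishes x x<N with ℕP.<-cmp x last | x ≟ k | x ≟ suc k
    ... | tri< x<last _ _ | _        | _        = sweep-below x<last
    ... | tri≈ _ refl _   | _        | _        = trans sweep-here (cong (ℤ._- + 0) last-target)
    ... | tri> _ _ _      | yes refl | _        = trans (sweep-u last<k) X≡0
    ... | tri> _ _ _      | no _     | yes refl = trans (sweep-v last<k) Y≡0
    ... | tri> _ _ last<x | no x≢k   | no x≢k+1 =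
      ⊥-elim (x≢k+1 (ℕP.≤-antisym (ℕP.≤-pred (subst (x <_) (ℕP.+-comm k 2) x<N))
                                  (ℕP.≤∧≢⇒< last<x (x≢k ∘ sym))))
  ... | no X≢0 | _
    rewrite allZero-false N (sweep k 0 last X Y) k k<N (X≢0 ∘ trans (sym (sweep-u last<k))) = refl
  ... | yes _  | no Y≢0
    rewrite allZero-false N (sweep k 0 last X Y) (suc k) k+1<N (Y≢0 ∘ trans (sym (sweep-v last<k))) = refl

  end₁ : ∀ X Y → coeffDiff N [] (sweep k 1 last X Y) ≡ + 0
  end₁ X Y = coeffDiff-avoided N [] (sweep k 1 last X Y) last last<N [] λ lastExp≡0 →
    case trans (sym (trans (sweep-here {k} {1} {last} {X} {Y}) (cong (ℤ._- + 1) last-target))) lastExp≡0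
    of λ ()

  module UFan = Fan k k ℕP.≤-refl (λ U V → U ℤ.- + 1) (λ U V → V) (sweep-⊖u k)
  module VFan = Fan k (suc k) (ℕP.n≤1+n k) (λ U V → U) (λ U V → V ℤ.- + 1) (sweep-⊖v k)

  tailEdges junctionEdges sweepEdges : List (ℕ × ℕ)
  tailEdges     = fan (suc k) (suc c) b
  junctionEdges = (c , suc c) ∷ (c , k) ∷ (c , suc k) ∷ tailEdges
  sweepEdges    = fan k 2 a ++ junctionEdges

  tail-sweep : ∀ t X Y → coeffDiff N tailEdges (sweep k t (suc c) X Y)
                       ≡ coeffDiff N (tailEdges ++ []) (sweep k t (suc c) X Y)
  tail-sweep t X Y = cong (λ es → coeffDiff N es (sweep k t (suc c) X Y)) (sym (++-identityʳ tailEdges))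

  tail₀ : ∀ X Y → coeffDiff N tailEdges (sweep k 0 (suc c) X Y) ≡ hubsEmpty X Y
  tail₀ X Y = trans (tail-sweep 0 X Y)
    (trans (VFan.fan-sweep₀ b (suc c) (s≤s (s≤s z≤n)) last<k [] (λ _ _ _ → []) X Y) (end₀ X Y))

  tail₁ : ∀ X Y → coeffDiff N tailEdges (sweep k 1 (suc c) X Y) ≡ leak b ℤ.* hubsEmpty X (Y ℤ.- + 1)
  tail₁ X Y = begin
    coeffDiff N tailEdges (sweep k 1 (suc c) X Y)
      ≡⟨ trans (tail-sweep 1 X Y) (VFan.fan-sweep₁ b (suc c) (s≤s (s≤s z≤n)) last<k [] (λ _ _ _ → []) X Y) ⟩
    sign b ℤ.* coeffDiff N [] (sweep k 1 last X Y) ℤ.+ leak b ℤ.* coeffDiff N [] (sweep k 0 last X (Y ℤ.- + 1))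
      ≡⟨ cong₂ (λ u v → sign b ℤ.* u ℤ.+ leak b ℤ.* v) (end₁ X Y) (end₀ X (Y ℤ.- + 1)) ⟩
    sign b ℤ.* + 0 ℤ.+ leak b ℤ.* hubsEmpty X (Y ℤ.- + 1)
      ≡⟨ solve 3 (λ s l z → s :* con (+ 0) :+ l :* z := l :* z) refl
                 (sign b) (leak b) (hubsEmpty X (Y ℤ.- + 1)) ⟩
    leak b ℤ.* hubsEmpty X (Y ℤ.- + 1) ∎
    where
    open ≡-Reasoning
    open +-*-Solver

  private
    module Junction = AtVertex k c tailEdges (s≤s (s≤s z≤n)) c+1<k
      (fan-avoids (suc k) (suc c) b (ℕP.n<1+n c) (ℕP.<-trans (ℕP.<-trans (ℕP.n<1+n c) c+1<k) (ℕP.n<1+n k)))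

  junction₀ : ℤ → ℤ → ℤ
  junction₀ U V = ℤ.- hubsEmpty U (V ℤ.- + 1) ℤ.- hubsEmpty (U ℤ.- + 1) V
                  ℤ.- leak b ℤ.* hubsEmpty U (V ℤ.- + 1)

  junction₁ : ℤ → ℤ → ℤ
  junction₁ U V = hubsEmpty (U ℤ.- + 1) (V ℤ.- + 1) ℤ.+ leak b ℤ.* hubsEmpty U (V ℤ.- + 1 ℤ.- + 1)
                  ℤ.+ leak b ℤ.* hubsEmpty (U ℤ.- + 1) (V ℤ.- + 1)

  junction-sweep₀ : ∀ U V → coeffDiff N junctionEdges (sweep k 0 c U V) ≡ junction₀ U V
  junction-sweep₀ U V = trans (Junction.junction-step₀ U V)
    (cong₂ ℤ._-_ (cong₂ ℤ._-_ (cong ℤ.-_ (tail₀ U (V ℤ.- + 1))) (tail₀ (U ℤ.- + 1) V)) (tail₁ U V))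

  junction-sweep₁ : ∀ U V → coeffDiff N junctionEdges (sweep k 1 c U V) ≡ junction₁ U V
  junction-sweep₁ U V = trans (Junction.junction-step₁ U V)
    (cong₂ ℤ._+_ (cong₂ ℤ._+_ (tail₀ (U ℤ.- + 1) (V ℤ.- + 1)) (tail₁ U (V ℤ.- + 1)))
                 (tail₁ (U ℤ.- + 1) V))

  junction-avoids : ∀ x → 2 ≤ x → x < 2 + a → Avoids x junctionEdges
  junction-avoids x 2≤x x<c =
    (ℕP.<⇒≢ x<c , ℕP.<⇒≢ (ℕP.m<n⇒m<1+n x<c)) ∷ (ℕP.<⇒≢ x<c , ℕP.<⇒≢ x<k)
    ∷ (ℕP.<⇒≢ x<c , ℕP.<⇒≢ (ℕP.m<n⇒m<1+n x<k))
    ∷ fan-avoids (suc k) (suc c) b (ℕP.m<n⇒m<1+n x<c) (ℕP.m<n⇒m<1+n x<k)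
    where
    x<k : x < k
    x<k = ℕP.<-trans x<c (ℕP.<-trans (ℕP.n<1+n c) c+1<k)

  sweepValue : ℤ → ℤ → ℤ
  sweepValue U V = sign a ℤ.* junction₁ U V ℤ.+ leak a ℤ.* junction₀ (U ℤ.- + 1) V

  sweep-all : ∀ U V → coeffDiff N sweepEdges (sweep k 1 2 U V) ≡ sweepValue U V
  sweep-all U V =
    trans (UFan.fan-sweep₁ a 2 (s≤s (s≤s z≤n)) (ℕP.<-trans (ℕP.n<1+n c) c+1<k) junctionEdges junction-avoids U V)
    (cong₂ (λ u v → sign a ℤ.* u ℤ.+ leak a ℤ.* v) (junction-sweep₁ U V) (junction-sweep₀ (U ℤ.- + 1) V))

  value : ℤ → ℤ → ℤ
  value U V = sweepValue (U ℤ.- + 1 ℤ.- + 1) (V ℤ.- + 1 ℤ.- + 1 ℤ.- + 1)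
              ℤ.- sweepValue (U ℤ.- + 1 ℤ.- + 1 ℤ.- + 1) (V ℤ.- + 1 ℤ.- + 1)

  allEdges : List (ℕ × ℕ)
  allEdges = (1 , 2) ∷ (0 , k) ∷ (1 , k) ∷ (last , suc k) ∷ (0 , suc k) ∷ (k , suc k) ∷ sweepEdges

  allEdges-bounded : Bounded N allEdges
  allEdges-bounded =
    (1<N , 2<N) ∷ (0<N , k<N) ∷ (1<N , k<N) ∷ (last<N , k+1<N) ∷ (0<N , k+1<N) ∷ (k<N , k+1<N)
    ∷ All.++⁺ (fan-bounded k 2 a k<N c<N)
              ((c<N , ℕP.<-trans c+1<k k<N) ∷ (c<N , k<N) ∷ (c<N , k+1<N)
               ∷ fan-bounded (suc k) (suc c) b k+1<N last<N)
    where
    0<N : 0 < N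
    0<N = s≤s z≤n
    1<N : 1 < N
    1<N = s≤s (s≤s z≤n)
    2<N : 2 < N
    2<N = s≤s (s≤s (s≤s z≤n))
    c<N : c < N
    c<N = ℕP.<-trans (ℕP.<-trans (ℕP.n<1+n c) c+1<k) k<N

  peel : ∀ es {g h} x y → x < N → g x ≡ + 0 → g ⊖ y ≗ h →
         coeffDiff N ((x , y) ∷ es) g ≡ ℤ.- coeffDiff N es h
  peel es {g} x y x<N gx≡0 g⊖y≗h =
    trans (coeffDiff-forced N es g x y x<N gx≡0) (cong ℤ.-_ (coeffDiff-cong N es g⊖y≗h))

  -- v₁, v₂ and v_k have exponent 0, so each of their edges is taken by its other end.
  total : ∀ U V → coeffDiff N allEdges (sweep k 0 2 U V) ≡ value U V
  total U V = begin
    coeffDiff N allEdges (sweep k 0 2 U V)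
      ≡⟨ peel (drop 1 allEdges) 1 2 1<N (sweep-below 1<2) (sweep-⊖here k 0 2 U V 2<k) ⟩
    ℤ.- coeffDiff N (drop 1 allEdges) (sweep k 1 2 U V)
      ≡⟨ cong ℤ.-_ (peel (drop 2 allEdges) 0 k 0<N (sweep-below 0<2) (sweep-⊖u k 1 2 U V 2<k)) ⟩
    ℤ.- ℤ.- coeffDiff N (drop 2 allEdges) (sweep k 1 2 U₁ V)
      ≡⟨ cong (ℤ.-_ ∘ ℤ.-_) (peel (drop 3 allEdges) 1 k 1<N (sweep-below 1<2) (sweep-⊖u k 1 2 U₁ V 2<k)) ⟩
    ℤ.- ℤ.- ℤ.- coeffDiff N (drop 3 allEdges) (sweep k 1 2 U₂ V)
      ≡⟨ cong (ℤ.-_ ∘ ℤ.-_ ∘ ℤ.-_)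
              (peel (drop 4 allEdges) last (suc k) last<N last-empty (sweep-⊖v k 1 2 U₂ V 2<k)) ⟩
    ℤ.- ℤ.- ℤ.- ℤ.- coeffDiff N (drop 4 allEdges) (sweep k 1 2 U₂ V₁)
      ≡⟨ cong (ℤ.-_ ∘ ℤ.-_ ∘ ℤ.-_ ∘ ℤ.-_)
              (peel (drop 5 allEdges) 0 (suc k) 0<N (sweep-below 0<2) (sweep-⊖v k 1 2 U₂ V₁ 2<k)) ⟩
    ℤ.- ℤ.- ℤ.- ℤ.- ℤ.- coeffDiff N ((k , suc k) ∷ sweepEdges) (sweep k 1 2 U₂ V₂)
      ≡⟨ cong (ℤ.-_ ∘ ℤ.-_ ∘ ℤ.-_ ∘ ℤ.-_ ∘ ℤ.-_)
              (cong₂ ℤ._-_ (trans (coeffDiff-cong N sweepEdges (sweep-⊖u k 1 2 U₂ V₂ 2<k)) (sweep-all _ _))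
                           (trans (coeffDiff-cong N sweepEdges (sweep-⊖v k 1 2 U₂ V₂ 2<k)) (sweep-all _ _))) ⟩
    ℤ.- ℤ.- ℤ.- ℤ.- ℤ.- (sweepValue U₃ V₂ ℤ.- sweepValue U₂ V₃)
      ≡⟨ solve 2 (λ x y → :- :- :- :- :- (x :- y) := y :- x) refl (sweepValue U₃ V₂) (sweepValue U₂ V₃) ⟩
    sweepValue U₂ V₃ ℤ.- sweepValue U₃ V₂ ∎
    where
    open ≡-Reasoning
    open +-*-Solver
    U₁ U₂ U₃ V₁ V₂ V₃ : ℤ
    U₁ = U ℤ.- + 1
    U₂ = U₁ ℤ.- + 1
    U₃ = U₂ ℤ.- + 1
    V₁ = V ℤ.- + 1
    V₂ = V₁ ℤ.- + 1
    V₃ = V₂ ℤ.- + 1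
    0<2 : 0 < 2
    0<2 = s≤s z≤n
    1<2 : 1 < 2
    1<2 = s≤s (s≤s z≤n)
    0<N : 0 < N
    0<N = s≤s z≤n
    1<N : 1 < N
    1<N = s≤s (s≤s z≤n)
    last-empty : sweep k 1 2 U₂ V last ≡ + 0
    last-empty = trans (sweep-above 2<last (ℕP.<⇒≢ last<k) (ℕP.<⇒≢ (ℕP.m<n⇒m<1+n last<k))) last-target
      where
      2<last : 2 < last
      2<last = s≤s (s≤s (s≤s z≤n))

  sign-leak : ∀ n → (sign n ≡ + 1 × leak n ≡ + 0) ⊎ (sign n ≡ -[1+ 0 ] × leak n ≡ -[1+ 0 ])
  sign-leak zero = inj₁ (refl , refl)
  sign-leak (suc n) with sign-leak n
  ... | inj₁ (s≡1 , l≡0)   rewrite s≡1 | l≡0 = inj₂ (refl , refl)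
  ... | inj₂ (s≡-1 , l≡-1) rewrite s≡-1 | l≡-1 = inj₁ (refl , refl)

  nonvanishing : Σ ℕ λ au → Σ ℕ λ av → au ≤ 4 × av ≤ 4 × value (+ au) (+ av) ≢ + 0
  nonvanishing with sign-leak a | sign-leak b
  ... | inj₁ (sa , la) | inj₁ (_ , lb) = 4 , 3 , ℕP.≤-refl , ℕP.n≤1+n 3 , nonzero
    where
    nonzero : value (+ 4) (+ 3) ≢ + 0
    nonzero rewrite sa | la | lb = λ ()
  ... | inj₁ (sa , la) | inj₂ (_ , lb) = 3 , 4 , ℕP.n≤1+n 3 , ℕP.≤-refl , nonzero
    where
    nonzero : value (+ 3) (+ 4) ≢ + 0
    nonzero rewrite sa | la | lb = λ ()
  ... | inj₂ (sa , la) | inj₁ (_ , lb) = 4 , 3 , ℕP.≤-refl , ℕP.n≤1+n 3 , nonzero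
    where
    nonzero : value (+ 4) (+ 3) ≢ + 0
    nonzero rewrite sa | la | lb = λ ()
  ... | inj₂ (sa , la) | inj₂ (_ , lb) = 4 , 3 , ℕP.≤-refl , ℕP.n≤1+n 3 , nonzero
    where
    nonzero : value (+ 4) (+ 3) ≢ + 0
    nonzero rewrite sa | la | lb = λ ()

-- The edge list of G − v_kv₁v₂

applyFrom : {A : Set} → (ℕ → A) → ℕ → ℕ → List A
applyFrom g s zero    = []
applyFrom g s (suc n) = g s ∷ applyFrom g (suc s) n

applyUpTo≡applyFrom : ∀ {A : Set} (f : ℕ → A) g s n → (∀ j → f j ≡ g (s + j)) →
                      applyUpTo f n ≡ applyFrom g s n
applyUpTo≡applyFrom f g s zero    f≗ = refl
applyUpTo≡applyFrom f g s (suc n) f≗ = cong₂ _∷_ (trans (f≗ 0) (cong g (ℕP.+-identityʳ s)))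
  (applyUpTo≡applyFrom (f ∘ suc) g (suc s) n (λ j → trans (f≗ (suc j)) (cong g (ℕP.+-suc s j))))

map-range : ∀ {A : Set} (g : ℕ → A) s e → map g (range s e) ≡ applyFrom g s (suc e ∸ s)
map-range g s e = trans (cong (map g) (map-upTo (_+_ s) (suc e ∸ s)))
                        (trans (map-applyUpTo (_+_ s) g _) (applyUpTo≡applyFrom _ g s _ λ _ → refl))

applyFrom-cong : ∀ {A : Set} {g h : ℕ → A} s n → g ≗ h → applyFrom g s n ≡ applyFrom h s n
applyFrom-cong s zero    g≗h = refl
applyFrom-cong s (suc n) g≗h = cong₂ _∷_ (g≗h s) (applyFrom-cong (suc s) n g≗h)

applyFrom-suc : ∀ {A : Set} (g : ℕ → A) s n → applyFrom g (suc s) n ≡ applyFrom (g ∘ suc) s n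
applyFrom-suc g s zero    = refl
applyFrom-suc g s (suc n) = cong (g (suc s) ∷_) (applyFrom-suc g (suc s) n)

applyFrom-+ : ∀ {A : Set} (g : ℕ → A) s m n →
              applyFrom g s (m + n) ≡ applyFrom g s m ++ applyFrom g (s + m) n
applyFrom-+ g s zero    n = cong (λ s′ → applyFrom g s′ n) (sym (ℕP.+-identityʳ s))
applyFrom-+ g s (suc m) n = cong (g s ∷_) (trans (applyFrom-+ g (suc s) m n)
  (cong (λ s′ → applyFrom g (suc s) m ++ applyFrom g s′ n) (sym (ℕP.+-suc s m))))

map-applyFrom : ∀ {A B : Set} (f : A → B) g s n → map f (applyFrom g s n) ≡ applyFrom (f ∘ g) s n
map-applyFrom f g s zero    = refl
map-applyFrom f g s (suc n) = cong (f (g s) ∷_) (map-applyFrom f g (suc s) n)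

All-applyFrom : ∀ {A : Set} {P : A → Set} g s n → (∀ j → s ≤ j → P (g j)) → All P (applyFrom g s n)
All-applyFrom g s zero    Pg = []
All-applyFrom g s (suc n) Pg = Pg s ℕP.≤-refl ∷ All-applyFrom g (suc s) n (λ j s<j → Pg j (ℕP.<⇒≤ s<j))

pathEdge : ℕ → ℕ × ℕ
pathEdge j = (j , suc j)

spoke : ℕ → ℕ → ℕ × ℕ
spoke w j = (j , w)

fan-↭ : ∀ w s n → fan w s n ↭ applyFrom pathEdge s n ++ applyFrom (spoke w) s n
fan-↭ w s zero    = ↭.refl
fan-↭ w s (suc n) = ↭.prep (s , suc s) (↭.trans (↭.prep (s , w) (fan-↭ w (suc s) n))
  (↭.↭-sym (↭ₚ.shift (s , w) (applyFrom pathEdge (suc s) n) (applyFrom (spoke w) (suc s) n))))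

Kept : ℕ → ℕ × ℕ → Set
Kept k e = (sameEdge k 1 e ∨ sameEdge 1 2 e) ≡ false

isYes-false : ∀ {A : Set} (a? : Dec A) → ¬ A → isYes a? ≡ false
isYes-false a? ¬a = trans (isYes≗does a?) (dec-false a? ¬a)

kept-bool : ∀ a b c d e f → f ≡ false → b ≡ false ⊎ (c ≡ false × d ≡ false) →
            ((a ∧ f) ∨ (b ∧ c)) ∨ ((b ∧ d) ∨ (e ∧ f)) ≡ false
kept-bool a false c     d     e false refl (inj₁ refl)          rewrite ∧-zeroʳ a | ∧-zeroʳ e = refl
kept-bool a b     false false e false refl (inj₂ (refl , refl)) rewrite ∧-zeroʳ a | ∧-zeroʳ b | ∧-zeroʳ e = refl

kept : ∀ k {x y} → y ≢ 1 → x ≢ 1 ⊎ (y ≢ k × y ≢ 2) → Kept k (x , y)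
kept k {x} {y} y≢1 x≢1⊎y∉ =
  kept-bool (isYes (x ≟ k)) (isYes (x ≟ 1)) (isYes (y ≟ k)) (isYes (y ≟ 2)) (isYes (x ≟ 2)) (isYes (y ≟ 1))
  (isYes-false (y ≟ 1) y≢1)
  (Data.Sum.map (isYes-false (x ≟ 1)) (Data.Product.map (isYes-false (y ≟ k)) (isYes-false (y ≟ 2))) x≢1⊎y∉)

deletePath-++ : ∀ k xs ys → deletePath k 1 2 (xs ++ ys) ≡ deletePath k 1 2 xs ++ deletePath k 1 2 ys
deletePath-++ k []       ys = refl
deletePath-++ k (e ∷ xs) ys with sameEdge k 1 e ∨ sameEdge 1 2 e
... | true  = deletePath-++ k xs ys
... | false = cong (e ∷_) (deletePath-++ k xs ys)

deletePath-kept : ∀ k es → All (Kept k) es → deletePath k 1 2 es ≡ es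
deletePath-kept k []       []             = refl
deletePath-kept k (e ∷ es) (e-kept ∷ kept-es) with sameEdge k 1 e ∨ sameEdge 1 2 e | e-kept
... | false | refl = cong (e ∷_) (deletePath-kept k es kept-es)

deletePath-v₁vₖ : ∀ k es → deletePath k 1 2 ((1 , k) ∷ es) ≡ deletePath k 1 2 es
deletePath-v₁vₖ k es with sameEdge k 1 (1 , k) ∨ sameEdge 1 2 (1 , k) | v₁vₖ-deleted
  where
  v₁vₖ-deleted : (sameEdge k 1 (1 , k) ∨ sameEdge 1 2 (1 , k)) ≡ true
  v₁vₖ-deleted = trans (cong (λ b → ((isYes (1 ≟ k) ∧ isYes (k ≟ 1)) ∨ b) ∨ sameEdge 1 2 (1 , k))
                              (trans (isYes≗does (k ≟ k)) (dec-true (k ≟ k) refl)))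
                        (cong (_∨ sameEdge 1 2 (1 , k)) (∨-zeroʳ (isYes (1 ≟ k) ∧ isYes (k ≟ 1))))
... | true | refl = refl

shift : ℕ × ℕ → ℕ × ℕ
shift (x , y) = (x ∸ 1 , y ∸ 1)

graphPoly≡prodDiff : ∀ N es → graphPoly N es ≡ prodDiff N (map shift es)
graphPoly≡prodDiff N []             = refl
graphPoly≡prodDiff N ((x , y) ∷ es) = cong (mulLinDiff (x ∸ 1) (y ∸ 1)) (graphPoly≡prodDiff N es)

2+a+b∸a : ∀ a b → suc (suc (a + b)) ∸ a ≡ suc (suc b)
2+a+b∸a zero    b = refl
2+a+b∸a (suc a) b = 2+a+b∸a a b

regroup : ∀ (e₁ e₂ e₃ e₄ e₅ e₆ e₇ e₈ e₉ Pa Ua Pb Vb : List (ℕ × ℕ)) →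
  (e₁ ++ (Pa ++ (e₇ ++ Pb))) ++ ((e₂ ++ (e₃ ++ (Ua ++ e₈))) ++ (e₆ ++ ((e₉ ++ (Vb ++ e₄)) ++ e₅)))
  ↭ e₁ ++ (e₂ ++ (e₃ ++ (e₄ ++ (e₅ ++ (e₆ ++ ((Pa ++ Ua) ++ (e₇ ++ (e₈ ++ (e₉ ++ (Pb ++ Vb))))))))))
regroup e₁ e₂ e₃ e₄ e₅ e₆ e₇ e₈ e₉ Pa Ua Pb Vb =
  prove 13
    ((E₁ ⊕ (PA ⊕ (E₇ ⊕ PB))) ⊕ ((E₂ ⊕ (E₃ ⊕ (UA ⊕ E₈))) ⊕ (E₆ ⊕ ((E₉ ⊕ (VB ⊕ E₄)) ⊕ E₅))))
    (E₁ ⊕ (E₂ ⊕ (E₃ ⊕ (E₄ ⊕ (E₅ ⊕ (E₆ ⊕ ((PA ⊕ UA) ⊕ (E₇ ⊕ (E₈ ⊕ (E₉ ⊕ (PB ⊕ VB)))))))))))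
    (e₁ ∷ e₂ ∷ e₃ ∷ e₄ ∷ e₅ ∷ e₆ ∷ e₇ ∷ e₈ ∷ e₉ ∷ Pa ∷ Ua ∷ Pb ∷ Vb ∷ [])
  where
  E₁ E₂ E₃ E₄ E₅ E₆ E₇ E₈ E₉ PA UA PB VB : Expr 13
  E₁ = var (# 0)
  E₂ = var (# 1)
  E₃ = var (# 2)
  E₄ = var (# 3)
  E₅ = var (# 4)
  E₆ = var (# 5)
  E₇ = var (# 6)
  E₈ = var (# 7)
  E₉ = var (# 8)
  PA = var (# 9)
  UA = var (# 10)
  PB = var (# 11)
  VB = var (# 12)

module GraphEdges (a b : ℕ) where

  open Evaluation a b using (k; c; last; allEdges)

  i : ℕ
  i = 3 + a

  uSpokes vSpokes : List (ℕ × ℕ)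
  uSpokes = applyFrom (spoke (k + 1)) 1 (3 + a)
  vSpokes = applyFrom (spoke (k + 2)) (3 + a) (2 + b)

  edgesG≡ : edgesG k i
          ≡ applyFrom pathEdge 1 (3 + a + b) ++ (1 , k) ∷ uSpokes ++ (k + 1 , k + 2) ∷ vSpokes ++ (1 , k + 2) ∷ []
  edgesG≡ = cong₂ _++_ (map-range pathEdge 1 (k ∸ 1))
    (cong ((1 , k) ∷_) (cong₂ _++_ (map-range (spoke (k + 1)) 1 i)
      (cong ((k + 1 , k + 2) ∷_) (cong (_++ (1 , k + 2) ∷ [])
        (trans (map-range (spoke (k + 2)) i k) (cong (applyFrom (spoke (k + 2)) i) (2+a+b∸a a b)))))))

  remaining : List (ℕ × ℕ)
  remaining = applyFrom pathEdge 2 (2 + a + b) ++ uSpokes ++ (k + 1 , k + 2) ∷ vSpokes ++ (1 , k + 2) ∷ []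

  deletePath≡ : deletePath k 1 2 (edgesG k i) ≡ remaining
  deletePath≡ = begin
    deletePath k 1 2 (edgesG k i)
      ≡⟨ cong (deletePath k 1 2) edgesG≡ ⟩
    deletePath k 1 2 (applyFrom pathEdge 1 (3 + a + b) ++ (1 , k) ∷ spokes)
      ≡⟨ deletePath-++ k (applyFrom pathEdge 1 (3 + a + b)) _ ⟩
    -- the edge (1 , 2) at the head of the path block is deleted by computation
    deletePath k 1 2 (applyFrom pathEdge 2 (2 + a + b)) ++ deletePath k 1 2 ((1 , k) ∷ spokes)
      ≡⟨ cong₂ _++_ (deletePath-kept k _ path-kept)
                    (trans (deletePath-v₁vₖ k spokes) (deletePath-kept k spokes spokes-kept)) ⟩
    remaining ∎
    where
    open ≡-Reasoning
    spokes : List (ℕ × ℕ)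
    spokes = uSpokes ++ (k + 1 , k + 2) ∷ vSpokes ++ (1 , k + 2) ∷ []
    k+1≢k : k + 1 ≢ k
    k+1≢k = ℕP.m+1+n≢m k
    k+2≢k : k + 2 ≢ k
    k+2≢k = ℕP.m+1+n≢m k
    path-kept : All (Kept k) (applyFrom pathEdge 2 (2 + a + b))
    path-kept = All-applyFrom pathEdge 2 (2 + a + b) λ
      { (suc zero) (s≤s ()) ; (suc (suc j)) _ → kept k {suc (suc j)} {suc (suc (suc j))} (λ ()) (inj₁ λ ()) }
    spokes-kept : All (Kept k) spokes
    spokes-kept =
      All.++⁺ (All-applyFrom (spoke (k + 1)) 1 (3 + a) λ j _ → kept k {j} {k + 1} (λ ()) (inj₂ (k+1≢k , λ ())))
        (kept k {k + 1} {k + 2} (λ ()) (inj₂ (k+2≢k , λ ()))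
        ∷ All.++⁺ (All-applyFrom (spoke (k + 2)) (3 + a) (2 + b) λ j _ →
                     kept k {j} {k + 2} (λ ()) (inj₂ (k+2≢k , λ ())))
                  (kept k {1} {k + 2} (λ ()) (inj₂ (k+2≢k , λ ())) ∷ []))

  Pa Ua Pb Vb : List (ℕ × ℕ)
  Pa = applyFrom pathEdge 2 a
  Ua = applyFrom (spoke k) 2 a
  Pb = applyFrom pathEdge (3 + a) b
  Vb = applyFrom (spoke (suc k)) (3 + a) b

  k+2∸1 : k + 2 ∸ 1 ≡ suc k
  k+2∸1 = cong (_∸ 1) (ℕP.+-comm k 2)

  shift-path : map shift (applyFrom pathEdge 2 (2 + a + b)) ≡ (1 , 2) ∷ (Pa ++ (c , suc c) ∷ Pb)
  shift-path = trans (map-applyFrom shift pathEdge 2 (2 + a + b))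
    (trans (applyFrom-suc (shift ∘ pathEdge) 1 (2 + a + b))
      (cong ((1 , 2) ∷_) (trans (cong (applyFrom pathEdge 2) (sym (ℕP.+-suc a b)))
                                (applyFrom-+ pathEdge 2 a (suc b)))))

  shift-uSpokes : map shift uSpokes ≡ (0 , k) ∷ (1 , k) ∷ (Ua ++ (c , k) ∷ [])
  shift-uSpokes = trans (map-applyFrom shift (spoke (k + 1)) 1 (3 + a))
    (trans (applyFrom-suc (shift ∘ spoke (k + 1)) 0 (3 + a))
      (trans (applyFrom-cong 0 (3 + a) λ j → cong (j ,_) (ℕP.m+n∸n≡m k 1))
        (cong (λ es → (0 , k) ∷ (1 , k) ∷ es)
          (trans (cong (applyFrom (spoke k) 2) (ℕP.+-comm 1 a)) (applyFrom-+ (spoke k) 2 a 1)))))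

  shift-vSpokes : map shift vSpokes ≡ (c , suc k) ∷ (Vb ++ (last , suc k) ∷ [])
  shift-vSpokes = trans (map-applyFrom shift (spoke (k + 2)) (3 + a) (2 + b))
    (trans (applyFrom-suc (shift ∘ spoke (k + 2)) (2 + a) (2 + b))
      (trans (applyFrom-cong (2 + a) (2 + b) λ j → cong (j ,_) k+2∸1)
        (cong ((c , suc k) ∷_)
          (trans (cong (applyFrom (spoke (suc k)) (3 + a)) (ℕP.+-comm 1 b))
                 (applyFrom-+ (spoke (suc k)) (3 + a) b 1)))))

  shift-remaining : map shift remaining
    ≡ ((1 , 2) ∷ (Pa ++ (c , suc c) ∷ Pb))
      ++ (((0 , k) ∷ (1 , k) ∷ (Ua ++ (c , k) ∷ []))
      ++ ((k , suc k) ∷ (((c , suc k) ∷ (Vb ++ (last , suc k) ∷ [])) ++ (0 , suc k) ∷ [])))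
  shift-remaining =
    trans (map-++ shift (applyFrom pathEdge 2 (2 + a + b)) _) (cong₂ _++_ shift-path
      (trans (map-++ shift uSpokes _) (cong₂ _++_ shift-uSpokes
        (cong₂ _∷_ (cong₂ _,_ (ℕP.m+n∸n≡m k 1) k+2∸1)
          (trans (map-++ shift vSpokes _) (cong₂ _++_ shift-vSpokes (cong (λ y → (0 , y) ∷ []) k+2∸1)))))))

  shift-deletePath-↭ : map shift (deletePath k 1 2 (edgesG k i)) ↭ allEdges
  shift-deletePath-↭ = ↭.↭-trans (↭.↭-reflexive (trans (cong (map shift) deletePath≡) shift-remaining))
    (↭.↭-trans (regroup ((1 , 2) ∷ []) ((0 , k) ∷ []) ((1 , k) ∷ []) ((last , suc k) ∷ [])
                        ((0 , suc k) ∷ []) ((k , suc k) ∷ []) ((c , suc c) ∷ []) ((c , k) ∷ [])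
                        ((c , suc k) ∷ []) Pa Ua Pb Vb)
      (↭ₚ.++⁺ˡ ((1 , 2) ∷ (0 , k) ∷ (1 , k) ∷ (last , suc k) ∷ (0 , suc k) ∷ (k , suc k) ∷ [])
        (↭ₚ.++⁺ (↭.↭-sym (fan-↭ k 2 a))
          (↭ₚ.++⁺ˡ ((c , suc c) ∷ (c , k) ∷ (c , suc k) ∷ []) (↭.↭-sym (fan-↭ (suc k) (3 + a) b))))))

-- The monomial

chosenExponent : (k au av x : ℕ) → ℕ
chosenExponent k au av x =
  if does (x ≟ k) then au else
  if does (x ≟ suc k) then av else
  if does (1 <? x) ∧ does (x <? k ∸ 1) then 2 else 0

if-≤2 : ∀ b → (if b then 2 else 0) ≤ 2
if-≤2 true  = ℕP.≤-refl
if-≤2 false = z≤n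

module _ {k au av x : ℕ} where

  chosenExponent-u : x ≡ k → chosenExponent k au av x ≡ au
  chosenExponent-u refl rewrite dec-true (x ≟ x) refl = refl

  chosenExponent-v : x ≡ suc k → chosenExponent k au av x ≡ av
  chosenExponent-v refl rewrite dec-false (x ≟ k) ℕP.1+n≢n | dec-true (x ≟ x) refl = refl

  chosenExponent-path : x ≢ k → x ≢ suc k → + chosenExponent k au av x ≡ pathTarget k x
  chosenExponent-path x≢k x≢k+1 rewrite dec-false (x ≟ k) x≢k | dec-false (x ≟ suc k) x≢k+1 = if-float +_ _

  chosenExponent-≤2 : x ≢ k → x ≢ suc k → chosenExponent k au av x ≤ 2
  chosenExponent-≤2 x≢k x≢k+1 rewrite dec-false (x ≟ k) x≢k | dec-false (x ≟ suc k) x≢k+1 = if-≤2 _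

expOf-tabulate : ∀ n (h : ℕ → ℕ) x → x < n → expOf (tabulate {n = n} (h ∘ toℕ)) (suc x) ≡ h x
expOf-tabulate (suc n) h zero    _         = refl
expOf-tabulate (suc n) h (suc x) (s≤s x<n) = expOf-tabulate n (h ∘ suc) x x<n

expOf-tabulate-≥ : ∀ n (h : ℕ → ℕ) x → n ≤ x → expOf (tabulate {n = n} (h ∘ toℕ)) (suc x) ≡ 0
expOf-tabulate-≥ zero    h x       _         = refl
expOf-tabulate-≥ (suc n) h (suc x) (s≤s n≤x) = expOf-tabulate-≥ n (h ∘ suc) x n≤x

sweep-start : ∀ {k U V} x → 2 < k → x ≢ k → x ≢ suc k → sweep k 0 2 U V x ≡ pathTarget k x
sweep-start 0 _ _ _ = sweep-below (s≤s z≤n)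
sweep-start 1 _ _ _ = sweep-below (s≤s (s≤s z≤n))
sweep-start 2 _ _ _ = trans sweep-here (ℤP.+-identityʳ _)
sweep-start (suc (suc (suc x))) _ x≢k x≢k+1 = sweep-above (s≤s (s≤s (s≤s z≤n))) x≢k x≢k+1

GoodMonomial : ℕ → ℕ → Set
GoodMonomial k i = Σ (Monomial (k + 2)) (λ α →
    coeff (graphPoly (k + 2) (deletePath k 1 2 (edgesG k i))) α ≢ ℤ⁺ 0
  × expOf α 1 ≡ 0 × expOf α 2 ≡ 0 × expOf α k ≡ 0
  × ((r : ℕ) → 3 ≤ r → r ≤ k ∸ 1 → expOf α r ≤ 2)
  × expOf α (k + 1) ≤ 4
  × expOf α (k + 2) ≤ 4)

module Witness (a b : ℕ) where

  open Evaluation a b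
  open GraphEdges a b using (i; shift-deletePath-↭)

  au av : ℕ
  au = proj₁ nonvanishing
  av = proj₁ (proj₂ nonvanishing)

  au≤4 : au ≤ 4
  au≤4 = proj₁ (proj₂ (proj₂ nonvanishing))

  av≤4 : av ≤ 4
  av≤4 = proj₁ (proj₂ (proj₂ (proj₂ nonvanishing)))

  value≢0 : value (+ au) (+ av) ≢ + 0
  value≢0 = proj₂ (proj₂ (proj₂ (proj₂ nonvanishing)))

  α : Monomial N
  α = tabulate (chosenExponent k au av ∘ toℕ)

  expOf-α : ∀ x → x < N → expOf α (suc x) ≡ chosenExponent k au av x
  expOf-α = expOf-tabulate N (chosenExponent k au av)

  exponents-α : exponents α ≗ sweep k 0 2 (+ au) (+ av)
  exponents-α x with x ≟ k | x ≟ suc k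
  ... | yes refl | _        =
    trans (cong +_ (trans (expOf-α k k<N) (chosenExponent-u {k} {au} {av} refl))) (sym (sweep-u 2<k))
  ... | no _     | yes refl =
    trans (cong +_ (trans (expOf-α (suc k) k+1<N) (chosenExponent-v {k} {au} {av} refl))) (sym (sweep-v 2<k))
  ... | no x≢k   | no x≢k+1 with x <? N
  ...   | yes x<N = trans (cong +_ (expOf-α x x<N))
                          (trans (chosenExponent-path {k} {au} {av} x≢k x≢k+1) (sym (sweep-start x 2<k x≢k x≢k+1)))
  ...   | no x≮N  = trans (cong +_ (expOf-tabulate-≥ N (chosenExponent k au av) x (ℕP.≮⇒≥ x≮N)))
                          (sym (trans (sweep-start x 2<k x≢k x≢k+1) beyond))
    where
    beyond : pathTarget k x ≡ + 0
    beyond rewrite dec-false (x <? last) (λ x<last → x≮N (ℕP.<-trans x<last last<N)) =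
      cong (if_then + 2 else + 0) (∧-zeroʳ _)

  coeff-α : coeff (graphPoly N (deletePath k 1 2 (edgesG k i))) α ≡ value (+ au) (+ av)
  coeff-α = begin
    coeff (graphPoly N D) α
      ≡⟨ cong (λ P → coeff P α) (graphPoly≡prodDiff N D) ⟩
    coeff (prodDiff N (map shift D)) α
      ≡⟨ coeff-prodDiff N (map shift D) (↭ₚ.All-resp-↭ (↭.↭-sym shift-deletePath-↭) allEdges-bounded) α ⟩
    coeffDiff N (map shift D) (exponents α)
      ≡⟨ coeffDiff-↭ N shift-deletePath-↭ (exponents α) ⟩
    coeffDiff N allEdges (exponents α)
      ≡⟨ coeffDiff-cong N allEdges exponents-α ⟩
    coeffDiff N allEdges (sweep k 0 2 (+ au) (+ av))
      ≡⟨ total (+ au) (+ av) ⟩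
    value (+ au) (+ av) ∎
    where
    open ≡-Reasoning
    D : List (ℕ × ℕ)
    D = deletePath k 1 2 (edgesG k i)

  expOf-α-u : expOf α (k + 1) ≡ au
  expOf-α-u = trans (cong (expOf α) (ℕP.+-comm k 1)) (trans (expOf-α k k<N) (chosenExponent-u {k} {au} {av} refl))

  expOf-α-v : expOf α (k + 2) ≡ av
  expOf-α-v =
    trans (cong (expOf α) (ℕP.+-comm k 2)) (trans (expOf-α (suc k) k+1<N) (chosenExponent-v {k} {au} {av} refl))

  expOf-α-vₖ : expOf α k ≡ 0
  expOf-α-vₖ rewrite expOf-α last last<N | dec-false (last ≟ k) (ℕP.<⇒≢ last<k)
                   | dec-false (last ≟ suc k) (ℕP.<⇒≢ (ℕP.m<n⇒m<1+n last<k))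
                   | dec-false (last <? last) (ℕP.n≮n last)
    = cong (if_then 2 else 0) (∧-zeroʳ (does (1 <? last)))

  expOf-α-path : (r : ℕ) → 3 ≤ r → r ≤ k ∸ 1 → expOf α r ≤ 2
  expOf-α-path (suc x) _ r≤last = subst (_≤ 2) (sym (expOf-α x (ℕP.<-trans x<k k<N)))
    (chosenExponent-≤2 {k} {au} {av} (ℕP.<⇒≢ x<k) (ℕP.<⇒≢ (ℕP.m<n⇒m<1+n x<k)))
    where
    x<k : x < k
    x<k = ℕP.≤-trans r≤last (ℕP.n≤1+n last)

  witness : GoodMonomial k i
  witness = α , value≢0 ∘ trans (sym coeff-α) , refl , refl , expOf-α-vₖ , expOf-α-path
              , subst (_≤ 4) (sym expOf-α-u) au≤4 , subst (_≤ 4) (sym expOf-α-v) av≤4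

theorem5p16 : (k i : ℕ) → 3 ≤ i → i ≤ k ∸ 1 →
    Σ (Monomial (k + 2)) (λ α →
        coeff (graphPoly (k + 2) (deletePath k 1 2 (edgesG k i))) α ≢ ℤ⁺ 0
      × expOf α 1 ≡ 0 × expOf α 2 ≡ 0 × expOf α k ≡ 0
      × ((r : ℕ) → 3 ≤ r → r ≤ k ∸ 1 → expOf α r ≤ 2)
      × expOf α (k + 1) ≤ 4
      × expOf α (k + 2) ≤ 4)
theorem5p16 zero     (suc (suc (suc a))) (s≤s (s≤s (s≤s _))) ()
theorem5p16 (suc k′) (suc (suc (suc a))) (s≤s (s≤s (s≤s _))) i≤k′ =
  subst (λ k → GoodMonomial k (3 + a)) (cong suc (ℕP.m+[n∸m]≡n i≤k′)) (Witness.witness a (k′ ∸ (3 + a)))
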